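{- Let $(a_n(q))_{n\ge1}$ be a sequence in $\mathbb{Z}[q]$ and $N\ge1$. Suppose $\prod_{d\mid N,\ \mu(d)=1} a_{N/d}(q^d)\equiv \prod_{d\mid N,\ \mu(d)=-1} a_{N/d}(q^d)\pmod{[N]_q}$, and $\sum_{d\mid n}\mu(d)a_{n/d}(q^d)\equiv0\pmod{[n]_q}$ for all $1\le n<N$. Then $[N]_q$ divides $\left(\sum_{d\mid N}\mu(d)\,a_{N/d}(q^d)\right)\cdot\prod_{d\mid N,\ d>1,\ \mu(d)=1} a_{N/d}(q^d)$ in $\mathbb{Z}[q]$.
   Context: $[n]_q=1+q+\cdots+q^{n-1}$; $\mu$ is the Möbius function; congruences are in $\mathbb{Z}[q]$; empty products equal $1$. -}

module Defs where

open import Data.Nat as ℕ using (ℕ; zero; suc; _∸_; _≤?_)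
open import Data.Nat.Divisibility using (_∣?_)
open import Data.Nat.DivMod using (_/_)
open import Data.Nat.Primality using (prime?)
open import Data.Integer as ℤ using (ℤ; 0ℤ; 1ℤ; -1ℤ; _≟_)
open import Data.List using (List; []; _∷_; _++_; replicate; map; foldr; filter; upTo)
open import Data.Product using (∃)
open import Relation.Binary.PropositionalEquality using (_≡_)
open import Relation.Nullary.Decidable using (_×-dec_; ⌊_⌋)
open import Data.Bool using (if_then_else_)

-- Polynomials in ℤ[q] as coefficient lists, lowest degree first.

Poly : Set
Poly = List ℤ

coeff : Poly → ℕ → ℤ
coeff []      _       = 0ℤ
coeff (c ∷ p) zero    = c
coeff (c ∷ p) (suc k) = coeff p k

-- equality of polynomials: all coefficients agree (trailing zeros irrelevant)
_≈ₚ_ : Poly → Poly → Set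
P ≈ₚ Q = ∀ k → coeff P k ≡ coeff Q k

infixl 6 _+ₚ_ _-ₚ_
infixl 7 _*ₚ_ _*ₛ_

_+ₚ_ : Poly → Poly → Poly
[]      +ₚ q       = q
(a ∷ p) +ₚ []      = a ∷ p
(a ∷ p) +ₚ (b ∷ q) = (a ℤ.+ b) ∷ (p +ₚ q)

_*ₛ_ : ℤ → Poly → Poly
c *ₛ p = map (c ℤ.*_) p

-ₚ_ : Poly → Poly
-ₚ p = map ℤ.-_ p

_-ₚ_ : Poly → Poly → Poly
p -ₚ q = p +ₚ (-ₚ q)

_*ₚ_ : Poly → Poly → Poly
[]      *ₚ q = []
(a ∷ p) *ₚ q = (a *ₛ q) +ₚ (0ℤ ∷ (p *ₚ q))

oneₚ : Poly
oneₚ = 1ℤ ∷ []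

-- substitution q ↦ q^d (for d ≥ 1):  P(q) ↦ P(q^d)
expand : ℕ → Poly → Poly
expand d []      = []
expand d (c ∷ p) = c ∷ (replicate (d ∸ 1) 0ℤ ++ expand d p)

_∣ₚ_ : Poly → Poly → Set
M ∣ₚ P = ∃ λ R → P ≈ₚ (M *ₚ R)

_≡_[modₚ_] : Poly → Poly → Poly → Set
P ≡ Q [modₚ M ] = M ∣ₚ (P -ₚ Q)

[_]q : ℕ → Poly
[ n ]q = replicate n 1ℤ

-- Möbius function: μ(n) = ∏_{p prime, p ∣ n} (0 if p² ∣ n, else -1)
-- (i.e. 0 if n has a square prime factor, (-1)^k if n is a product of
-- k distinct primes; μ(1) = 1).

μ-factor : ℕ → ℕ → ℤ
μ-factor n p = if ⌊ prime? p ×-dec (p ∣? n) ⌋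
               then (if ⌊ (p ℕ.* p) ∣? n ⌋ then 0ℤ else -1ℤ)
               else 1ℤ

μ : ℕ → ℤ
μ n = foldr ℤ._*_ 1ℤ (map (μ-factor n) (map suc (upTo n)))

-- Divisors of N, encoded as k with d = suc k, for d = 1, …, N.

divisorsPred : ℕ → List ℕ
divisorsPred N = filter (λ k → suc k ∣? N) (upTo N)

-- a_{N/d}(q^d), where d = suc k
term : (ℕ → Poly) → ℕ → ℕ → Poly
term a N k = expand (suc k) (a (N / suc k))

sumₚ : List Poly → Poly
sumₚ = foldr _+ₚ_ []

prodₚ : List Poly → Poly
prodₚ = foldr _*ₚ_ oneₚ

mobSum : (ℕ → Poly) → ℕ → Poly
mobSum a N = sumₚ (map (λ k → μ (suc k) *ₛ term a N k) (divisorsPred N))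

posProd : (ℕ → Poly) → ℕ → Poly
posProd a N = prodₚ (map (term a N) (filter (λ k → μ (suc k) ≟ 1ℤ) (divisorsPred N)))

negProd : (ℕ → Poly) → ℕ → Poly
negProd a N = prodₚ (map (term a N) (filter (λ k → μ (suc k) ≟ -1ℤ) (divisorsPred N)))

-- ∏_{d ∣ N, d > 1, μ(d) = 1} a_{N/d}(q^d)   (d = suc k > 1 ⟺ 1 ≤ k)
posProd>1 : (ℕ → Poly) → ℕ → Poly
posProd>1 a N = prodₚ (map (term a N)
  (filter (λ k → (1 ≤? k) ×-dec (μ (suc k) ≟ 1ℤ)) (divisorsPred N)))

-- Let x be the product to be shown divisible by [N]_q. The exponents g for which q^N - 1 divides
-- (q^g - 1) x are closed under multiples and differences, hence under gcd, and include N. If for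
-- every prime p ∣ N one of them is prime to p, descending along gcds reaches g = 1, and cancelling
-- q - 1 gives [N]_q ∣ x.
--
-- For a prime p ∣ N let m be the prime-to-p part of N and A d = a_{N/d}(q^d). As μ(p k) = -μ(k),
-- and μ(p k) = 0 when p ∣ k, every sum or product over the divisors of N regroups into one over the
-- divisors k of m involving A k and A (p k). Modulo the colon ideal (q^N - 1 : q^m - 1), the
-- hypothesis for N/d, substituted at q ↦ q^d, yields A d ≡ A (p d) for all 1 < d ∣ m by downward
-- induction on d. So the Möbius sum is ≡ A 1 - A p and, with R = ∏_{1<k∣m, μ(k)=1} A k and
-- Q = ∏_{k∣m, μ(k)=-1} A (p k), the two given products are ≡ A 1 · R · Q and Q · A p · R. Hence
-- x ≡ (A 1 - A p) · R · Q ≡ (positive product) - (negative product) ≡ 0, i.e. m is such an exponent.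

{-# OPTIONS --safe #-}
module Submission where

open import Defs

open import Algebra.Bundles using (CommutativeMonoid; CommutativeRing)
import Algebra.Properties.CommutativeSemigroup as CommutativeSemigroupProperties
open import Data.Bool using (true; false; if_then_else_)
open import Data.Integer as ℤ using (ℤ; 0ℤ; 1ℤ; -1ℤ)
import Data.Integer.Properties as ℤ
open import Data.List using ([]; _∷_; _++_; replicate; map; foldr; filter; applyUpTo; upTo)
open import Data.List.Properties using (map-∘)
open import Data.List.Relation.Unary.All using (_∷_)
open import Data.Nat as ℕ using (ℕ; zero; suc; _∸_; _≤_; _<_; _≤?_; z≤n; s≤s; NonZero; ≢-nonZero⁻¹; 2+)
import Data.Nat.Properties as ℕ
open import Data.Nat.Coprimality using (Coprime; coprime-divisor) renaming (sym to Coprime-sym)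
open import Data.Nat.Divisibility
  using ( _∣_; _∤_; _∣?_; 1∣_; ∣-refl; ∣-trans; ∣⇒≤; 0∣⇒≡0; >⇒∤; m∣m*n; n∣m*n
        ; ∣m+n∣m⇒∣n; ∣m∣n⇒∣m+n
        ; *-monoʳ-∣; *-monoˡ-∣; *-cancelˡ-∣; *-cancelʳ-∣
        ; quotient; quotient≢0; quotient-∣; quotient-<; m∣n⇒n≡m*quotient; m∣n⇒n≡quotient*m )
open import Data.Nat.DivMod using (_/_; m*n/o*n≡m/o)
open import Data.Nat.GCD using (gcd; gcd-GCD; gcd[m,n]∣m; gcd[m,n]∣n; module Bézout)
open import Data.Nat.Induction using (<-rec)
open import Data.Nat.ListAction using (product)
open import Data.Nat.Primality
  using (Prime; prime?; ¬prime[1]; prime⇒irreducible; prime⇒nonZero; prime⇒nonTrivial; euclidsLemma)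
open import Data.Nat.Primality.Factorisation using (factorise)
open import Data.Product using (_,_; _×_; ∃; ∃-syntax)
open import Data.Product.Function.NonDependent.Propositional using (_×-⇔_)
open import Data.Sum using (inj₁; inj₂)
open import Function using (id; _∘_; _⇔_; mk⇔; Equivalence)
open import Level using (0ℓ; _⊔_)
open import Relation.Binary.Bundles using (Setoid)
open import Relation.Binary.PropositionalEquality as ≡ using (_≡_; _≢_)
open import Relation.Binary.Structures using (IsEquivalence)
open import Relation.Nullary using (Dec; yes; no; does; ¬_; ¬?; contradiction)
open import Relation.Nullary.Decidable using (dec-true; dec-false; does-⇔; isYes≗does; ⌊_⌋; _×-dec_)
open import Relation.Unary using (Decidable)

-- Divisibility and prime-to-p parts

divisor-nonZero : ∀ {m n} .{{_ : NonZero n}} → m ∣ n → NonZero m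
divisor-nonZero {zero}  {n} 0∣n = contradiction (0∣⇒≡0 0∣n) (≢-nonZero⁻¹ n)
divisor-nonZero {suc m}     _   = _

prime-divisor : ∀ n → ∃[ p ] Prime p × p ∣ 2+ n
prime-divisor n with factorise (2+ n)
... | record { factors = [] ; isFactorisation = () }
... | record { factors = p ∷ ps ; isFactorisation = n≡∏ ; factorsPrime = p-prime ∷ _ } =
  p , p-prime , ≡.subst (p ∣_) (≡.sym n≡∏) (m∣m*n (product ps))

prime∤⇒coprime : ∀ {p k} → Prime p → p ∤ k → Coprime p k
prime∤⇒coprime p-prime p∤k (i∣p , i∣k) with prime⇒irreducible p-prime i∣p
... | inj₁ i≡1      = i≡1
... | inj₂ ≡.refl   = contradiction i∣k p∤k

prime∤-* : ∀ {p m n} → Prime p → p ∤ m → p ∤ n → p ∤ m ℕ.* n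
prime∤-* {m = m} {n} p-prime p∤m p∤n p∣mn with euclidsLemma m n p-prime p∣mn
... | inj₁ p∣m = p∤m p∣m
... | inj₂ p∣n = p∤n p∣n

coprime-∣-cancel : ∀ {j p} k → Coprime j p → j ∣ p ℕ.* k ⇔ j ∣ k
coprime-∣-cancel {p = p} k j⊥p = mk⇔ (coprime-divisor j⊥p) (λ j∣k → ∣-trans j∣k (n∣m*n p))

⌊⌋-⇔ : ∀ {a b} {A : Set a} {B : Set b} → A ⇔ B → (A? : Dec A) (B? : Dec B) → ⌊ A? ⌋ ≡ ⌊ B? ⌋
⌊⌋-⇔ A⇔B A? B? = ≡.trans (isYes≗does A?) (≡.trans (does-⇔ A⇔B A? B?) (≡.sym (isYes≗does B?)))

prime∣prime⇒≡ : ∀ {p q} → Prime p → Prime q → p ∣ q → p ≡ q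
prime∣prime⇒≡ p-prime q-prime p∣q with prime⇒irreducible q-prime p∣q
... | inj₁ ≡.refl = contradiction p-prime ¬prime[1]
... | inj₂ p≡q    = p≡q

record PrimeToPart (p N m : ℕ) : Set where
  field
    p∣N     : p ∣ N
    m∣N     : m ∣ N
    p∤m     : p ∤ m
    maximal : ∀ {k} → k ∣ N → p ∤ k → k ∣ m

primeToPart : ∀ {p} → Prime p → ∀ {N} .{{_ : NonZero N}} → p ∣ N → ∃ (PrimeToPart p N)
primeToPart {p} p-prime {N} = <-rec Goal build N
  where
  instance _ = prime⇒nonTrivial p-prime
  Goal : ℕ → Set
  Goal N = .{{NonZero N}} → p ∣ N → ∃ (PrimeToPart p N)
  build : ∀ N → (∀ {M} → M < N → Goal M) → Goal N
  build N rec p∣N = extend (p ∣? q)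
    where
    instance _ = quotient≢0 p∣N
    q : ℕ
    q = quotient p∣N
    N≡p*q : N ≡ p ℕ.* q
    N≡p*q = m∣n⇒n≡m*quotient p∣N
    into-q : ∀ {k} → k ∣ N → p ∤ k → k ∣ q
    into-q k∣N p∤k =
      coprime-divisor (Coprime-sym (prime∤⇒coprime p-prime p∤k)) (≡.subst (_ ∣_) N≡p*q k∣N)
    extend : Dec (p ∣ q) → ∃ (PrimeToPart p N)
    extend (no p∤q) = q , record
      { p∣N = p∣N ; m∣N = quotient-∣ p∣N ; p∤m = p∤q ; maximal = into-q }
    extend (yes p∣q) with rec (quotient-< p∣N) p∣q
    ... | m , part = m , record
      { p∣N     = p∣N
      ; m∣N     = ∣-trans (PrimeToPart.m∣N part) (quotient-∣ p∣N)
      ; p∤m     = PrimeToPart.p∤m part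
      ; maximal = λ k∣N p∤k → PrimeToPart.maximal part (into-q k∣N p∤k) p∤k
      }

primeToPart-÷ : ∀ {p N m d} → Prime p → .{{_ : NonZero d}} →
                PrimeToPart p (N ℕ.* d) (m ℕ.* d) → PrimeToPart p N m
primeToPart-÷ {p} {N} {m} {d} p-prime part = record
  { p∣N     = p∣N
  ; m∣N     = *-cancelʳ-∣ d P.m∣N
  ; p∤m     = λ p∣m → P.p∤m (∣-trans p∣m (m∣m*n d))
  ; maximal = λ k∣N p∤k → *-cancelʳ-∣ d (P.maximal (*-monoˡ-∣ d k∣N) (prime∤-* p-prime p∤k p∤d))
  }
  where
  module P = PrimeToPart part
  p∤d : p ∤ d
  p∤d p∣d = P.p∤m (∣-trans p∣d (n∣m*n m))
  p∣N : p ∣ N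
  p∣N with euclidsLemma N d p-prime P.p∣N
  ... | inj₁ p∣N = p∣N
  ... | inj₂ p∣d = contradiction p∣d p∤d

divisor-descent : ∀ {ℓ} {P : ℕ → Set ℓ} {m} .{{_ : NonZero m}} →
                  (∀ d → d ∣ m → (∀ e → e ∣ m → d < e → P e) → P d) → ∀ d → d ∣ m → P d
divisor-descent {P = P} {m} step d = <-rec Goal descend (m ∸ d) d ≡.refl
  where
  Goal : ℕ → Set _
  Goal k = ∀ d → m ∸ d ≡ k → d ∣ m → P d
  descend : ∀ k → (∀ {j} → j < k → Goal j) → Goal k
  descend k rec d ≡.refl d∣m =
    step d d∣m λ e e∣m d<e → rec (ℕ.∸-monoʳ-< d<e (∣⇒≤ e∣m)) e ≡.refl e∣m

module _ {ℓ} {P : ℕ → Set ℓ} where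

  gcd-closed : (∀ {n} t → P n → P (t ℕ.* n)) → (∀ {a b} → P (a ℕ.+ b) → P b → P a)
             → ∀ {m n} → P m → P n → P (gcd m n)
  gcd-closed *-closed ∸-closed {m} {n} Pm Pn with Bézout.identity (gcd-GCD m n)
  ... | Bézout.+- x y eq = ∸-closed (≡.subst P (≡.sym eq) (*-closed x Pm)) (*-closed y Pn)
  ... | Bézout.-+ x y eq = ∸-closed (≡.subst P (≡.sym eq) (*-closed y Pn)) (*-closed x Pm)

  gcd-closed⇒1 : (∀ {m n} → P m → P n → P (gcd m n))
               → ∀ {N} .{{_ : NonZero N}} → P N
               → (∀ {p} → Prime p → p ∣ N → ∃[ m ] P m × p ∤ m) → P 1
  gcd-closed⇒1 gcd-closed′ {N} PN prime-free = <-rec Goal descend N ∣-refl PN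
    where
    Goal : ℕ → Set ℓ
    Goal g = g ∣ N → P g → P 1
    descend : ∀ g → (∀ {d} → d < g → Goal d) → Goal g
    descend 0             rec 0∣N _  = contradiction (0∣⇒≡0 0∣N) (≢-nonZero⁻¹ N)
    descend 1             rec _   P1 = P1
    descend g@(2+ n) rec g∣N Pg with prime-divisor n
    ... | p , p-prime , p∣g with prime-free p-prime (∣-trans p∣g g∣N)
    ...   | m , Pm , p∤m = rec gcd<g (∣-trans (gcd[m,n]∣m g m) g∣N) (gcd-closed′ Pg Pm)
      where
      gcd<g : gcd g m < g
      gcd<g = ℕ.≤∧≢⇒< (∣⇒≤ (gcd[m,n]∣m g m))
                     (λ gcd≡g → p∤m (∣-trans p∣g (≡.subst (_∣ m) gcd≡g (gcd[m,n]∣n g m))))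

-- Big operators over 1, …, n and over divisors

-- Kept outside BigOperators so that monoids with the same operations but different
-- equalities (ℤ[q] and its quotients) share their big operators definitionally.
foldRange : ∀ {a} {A : Set a} → (A → A → A) → A → ℕ → (ℕ → A) → A
foldRange _∙_ ε zero    f = ε
foldRange _∙_ ε (suc n) f = foldRange _∙_ ε n f ∙ f (suc n)

module BigOperators {c ℓ} (M : CommutativeMonoid c ℓ) where

  open CommutativeMonoid M
  open import Algebra.Properties.CommutativeSemigroup commutativeSemigroup using (interchange)
  open import Relation.Binary.Reasoning.Setoid setoid

  ⨁ : ℕ → (ℕ → Carrier) → Carrier
  ⨁ = foldRange _∙_ ε

  when : ∀ {p} {P : Set p} → Dec P → Carrier → Carrier
  when P? x = if does P? then x else ε

  ⨁∣ : ℕ → (ℕ → Carrier) → Carrier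
  ⨁∣ n f = ⨁ n (λ d → when (d ∣? n) (f d))

  module _ {p} {P : Set p} where

    when-yes : ∀ (P? : Dec P) {x} → P → when P? x ≈ x
    when-yes (yes _) _ = refl
    when-yes (no ¬P) P = contradiction P ¬P

    when-no : ∀ (P? : Dec P) {x} → ¬ P → when P? x ≈ ε
    when-no (yes P) ¬P = contradiction P ¬P
    when-no (no _)  _  = refl

    when-ε : ∀ (P? : Dec P) {x} → (P → x ≈ ε) → when P? x ≈ ε
    when-ε (yes P) x≈ε = x≈ε P
    when-ε (no _)  _   = refl

    when-cong : ∀ {q} {Q : Set q} (P? : Dec P) (Q? : Dec Q) {x y} →
                (P → Q) → (Q → P) → (P → x ≈ y) → when P? x ≈ when Q? y
    when-cong (yes P) (yes _) _   _   x≈y = x≈y P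
    when-cong (yes P) (no ¬Q) P→Q _   _   = contradiction (P→Q P) ¬Q
    when-cong (no ¬P) (yes Q) _   Q→P _   = contradiction (Q→P Q) ¬P
    when-cong (no _)  (no _)  _   _   _   = refl

    when-when : ∀ {q} {Q : Set q} (P? : Dec P) (Q? : Dec Q) {x} → when P? (when Q? x) ≈ when (P? ×-dec Q?) x
    when-when (yes _) Q? = refl
    when-when (no _)  Q? = refl

  ⨁-cong : ∀ n {f g} → (∀ d → 1 ≤ d → d ≤ n → f d ≈ g d) → ⨁ n f ≈ ⨁ n g
  ⨁-cong zero    f≈g = refl
  ⨁-cong (suc n) f≈g =
    ∙-cong (⨁-cong n λ d 1≤d d≤n → f≈g d 1≤d (ℕ.m≤n⇒m≤1+n d≤n)) (f≈g (suc n) (s≤s z≤n) ℕ.≤-refl)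

  ⨁-ε : ∀ n {f} → (∀ d → 1 ≤ d → d ≤ n → f d ≈ ε) → ⨁ n f ≈ ε
  ⨁-ε n f≈ε = trans (⨁-cong n f≈ε) (⨁-const-ε n)
    where
    ⨁-const-ε : ∀ n → ⨁ n (λ _ → ε) ≈ ε
    ⨁-const-ε zero    = refl
    ⨁-const-ε (suc n) = trans (identityʳ _) (⨁-const-ε n)

  ⨁-∙ : ∀ n f g → ⨁ n (λ d → f d ∙ g d) ≈ ⨁ n f ∙ ⨁ n g
  ⨁-∙ zero    f g = sym (identityˡ ε)
  ⨁-∙ (suc n) f g = trans (∙-congʳ (⨁-∙ n f g)) (interchange (⨁ n f) (⨁ n g) (f (suc n)) (g (suc n)))

  ⨁-+ : ∀ a b f → ⨁ (a ℕ.+ b) f ≈ ⨁ a f ∙ ⨁ b (λ i → f (a ℕ.+ i))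
  ⨁-+ a zero    f = trans (reflexive (≡.cong (λ n → ⨁ n f) (ℕ.+-identityʳ a))) (sym (identityʳ _))
  ⨁-+ a (suc b) f = begin
    ⨁ (a ℕ.+ suc b) f                                   ≡⟨ ≡.cong (λ n → ⨁ n f) (ℕ.+-suc a b) ⟩
    ⨁ (a ℕ.+ b) f ∙ f (suc (a ℕ.+ b))                   ≈⟨ ∙-cong (⨁-+ a b f) (reflexive (≡.cong f a+[1+b])) ⟩
    (⨁ a f ∙ ⨁ b (λ i → f (a ℕ.+ i))) ∙ f (a ℕ.+ suc b) ≈⟨ assoc _ _ _ ⟩
    ⨁ a f ∙ ⨁ (suc b) (λ i → f (a ℕ.+ i))               ∎
    where
    a+[1+b] : suc (a ℕ.+ b) ≡ a ℕ.+ suc b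
    a+[1+b] = ≡.sym (ℕ.+-suc a b)

  ⨁-head : ∀ n f → ⨁ (suc n) f ≈ f 1 ∙ ⨁ n (λ i → f (suc i))
  ⨁-head n f = trans (⨁-+ 1 n f) (∙-congʳ (identityˡ (f 1)))

  ⨁-extend : ∀ {m n} f → m ≤ n → (∀ d → m < d → d ≤ n → f d ≈ ε) → ⨁ n f ≈ ⨁ m f
  ⨁-extend {m} f m≤n f≈ε with ℕ.m≤n⇒∃[o]m+o≡n m≤n
  ... | k , ≡.refl = begin
    ⨁ (m ℕ.+ k) f                          ≈⟨ ⨁-+ m k f ⟩
    ⨁ m f ∙ ⨁ k (λ i → f (m ℕ.+ i))        ≈⟨ ∙-congˡ (⨁-ε k λ i 1≤i i≤k →
                                                 f≈ε (m ℕ.+ i) (ℕ.m<m+n m 1≤i) (ℕ.+-monoʳ-≤ m i≤k)) ⟩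
    ⨁ m f ∙ ε                              ≈⟨ identityʳ _ ⟩
    ⨁ m f                                  ∎

  ⨁-partition : ∀ {p} {P : ℕ → Set p} (P? : ∀ d → Dec (P d)) n f →
                ⨁ n f ≈ ⨁ n (λ d → when (¬? (P? d)) (f d)) ∙ ⨁ n (λ d → when (P? d) (f d))
  ⨁-partition P? n f = trans (⨁-cong n λ d _ _ → partition (P? d)) (⨁-∙ n _ _)
    where
    partition : ∀ {d} (D : Dec _) → f d ≈ when (¬? D) (f d) ∙ when D (f d)
    partition (yes _) = sym (identityˡ _)
    partition (no _)  = sym (identityʳ _)

  ⨁-multiples : ∀ p .{{_ : NonZero p}} t (f : ℕ → Carrier) →
                ⨁ (p ℕ.* t) (λ d → when (p ∣? d) (f d)) ≈ ⨁ t (λ k → f (p ℕ.* k))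
  ⨁-multiples p         zero    f = reflexive (≡.cong (λ n → ⨁ n (λ d → when (p ∣? d) (f d))) (ℕ.*-zeroʳ p))
  ⨁-multiples p@(suc q) (suc t) f = begin
    ⨁ (p ℕ.* suc t) g                                ≡⟨ ≡.cong (λ n → ⨁ n g) p[1+t]≡pt+p ⟩
    ⨁ (p ℕ.* t ℕ.+ p) g                              ≈⟨ ⨁-+ (p ℕ.* t) p g ⟩
    ⨁ (p ℕ.* t) g ∙ (⨁ q block ∙ g (p ℕ.* t ℕ.+ p))  ≈⟨ ∙-cong (⨁-multiples p t f)
                                                                (∙-cong (⨁-ε q interior) last) ⟩
    ⨁ t (λ k → f (p ℕ.* k)) ∙ (ε ∙ f (p ℕ.* suc t))  ≈⟨ ∙-congˡ (identityˡ _) ⟩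
    ⨁ (suc t) (λ k → f (p ℕ.* k))                    ∎
    where
    g block : ℕ → Carrier
    g d = when (p ∣? d) (f d)
    block i = g (p ℕ.* t ℕ.+ i)
    p[1+t]≡pt+p : p ℕ.* suc t ≡ p ℕ.* t ℕ.+ p
    p[1+t]≡pt+p = ≡.trans (ℕ.*-suc p t) (ℕ.+-comm p (p ℕ.* t))
    interior : ∀ i → 1 ≤ i → i ≤ q → block i ≈ ε
    interior i 1≤i i≤q = when-no (p ∣? _) λ p∣pt+i →
      ℕ.<⇒≱ (s≤s i≤q) (∣⇒≤ {{ℕ.>-nonZero 1≤i}} (∣m+n∣m⇒∣n p∣pt+i (m∣m*n t)))
    last : g (p ℕ.* t ℕ.+ p) ≈ f (p ℕ.* suc t)
    last = trans (when-yes (p ∣? _) (∣m∣n⇒∣m+n (m∣m*n t) ∣-refl))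
                 (reflexive (≡.cong f (≡.sym p[1+t]≡pt+p)))

  except : ℕ → (ℕ → Carrier) → ℕ → Carrier
  except j f i = if does (i ℕ.≟ j) then ε else f i

  except-≢ : ∀ {i j} f → i ≢ j → except j f i ≈ f i
  except-≢ {i} {j} f i≢j = reflexive (≡.cong (λ b → if b then ε else f i) (dec-false (i ℕ.≟ j) i≢j))

  except-≡ : ∀ j f → except j f j ≈ ε
  except-≡ j f = reflexive (≡.cong (λ b → if b then ε else f j) (dec-true (j ℕ.≟ j) ≡.refl))

  except-cong : ∀ {j f g} → (∀ {i} → i ≢ j → f i ≈ g i) → ∀ i → except j f i ≈ except j g i
  except-cong {j} {f} {g} f≈g i with i ℕ.≟ j
  ... | yes ≡.refl = trans (except-≡ j f) (sym (except-≡ j g))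
  ... | no  i≢j    = trans (except-≢ f i≢j) (trans (f≈g i≢j) (sym (except-≢ g i≢j)))

  ⨁-pick : ∀ {j} n f → 1 ≤ j → j ≤ n → ⨁ n f ≈ f j ∙ ⨁ n (except j f)
  ⨁-pick     zero    f 1≤j j≤0   = contradiction (ℕ.≤-trans 1≤j j≤0) λ ()
  ⨁-pick {j} (suc n) f 1≤j j≤1+n with j ℕ.≟ suc n
  ... | yes ≡.refl = begin
    ⨁ n f ∙ f j                     ≈⟨ comm _ _ ⟩
    f j ∙ ⨁ n f                     ≈⟨ ∙-congˡ (⨁-cong n λ i _ i≤n → except-≢ f (ℕ.<⇒≢ (s≤s i≤n))) ⟨
    f j ∙ ⨁ n (except j f)          ≈⟨ ∙-congˡ (trans (∙-congˡ (except-≡ j f)) (identityʳ _)) ⟨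
    f j ∙ ⨁ (suc n) (except j f)    ∎
  ... | no j≢1+n = begin
    ⨁ n f ∙ f (suc n)                    ≈⟨ ∙-congʳ (⨁-pick n f 1≤j j≤n) ⟩
    (f j ∙ ⨁ n (except j f)) ∙ f (suc n) ≈⟨ assoc _ _ _ ⟩
    f j ∙ (⨁ n (except j f) ∙ f (suc n)) ≈⟨ ∙-congˡ (∙-congˡ (except-≢ f (j≢1+n ∘ ≡.sym))) ⟨
    f j ∙ ⨁ (suc n) (except j f)         ∎
    where
    j≤n : j ≤ n
    j≤n = ℕ.≤-pred (ℕ.≤∧≢⇒< j≤1+n j≢1+n)

  ⨁∣-cong : ∀ n {f g} → (∀ d → 1 ≤ d → d ∣ n → f d ≈ g d) → ⨁∣ n f ≈ ⨁∣ n g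
  ⨁∣-cong n f≈g = ⨁-cong n λ d 1≤d _ → when-cong (d ∣? n) (d ∣? n) id id (f≈g d 1≤d)

  ⨁∣-∙ : ∀ n f g → ⨁∣ n (λ d → f d ∙ g d) ≈ ⨁∣ n f ∙ ⨁∣ n g
  ⨁∣-∙ n f g = trans (⨁-cong n λ d _ _ → when-∙ (d ∣? n)) (⨁-∙ n _ _)
    where
    when-∙ : ∀ {d} (D : Dec (d ∣ n)) → when D (f d ∙ g d) ≈ when D (f d) ∙ when D (g d)
    when-∙ (yes _) = refl
    when-∙ (no _)  = sym (identityˡ ε)

  ⨁∣-extend : ∀ {m n} .{{_ : NonZero m}} f → m ≤ n → ⨁ n (λ d → when (d ∣? m) (f d)) ≈ ⨁∣ m f
  ⨁∣-extend f m≤n = ⨁-extend _ m≤n λ d m<d _ → when-no (d ∣? _) (>⇒∤ m<d)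

  ⨁∣-pull-1 : ∀ n .{{_ : NonZero n}} f → ⨁∣ n f ≈ f 1 ∙ ⨁∣ n (λ k → when (2 ≤? k) (f k))
  ⨁∣-pull-1 n f = begin
    ⨁∣ n f                                    ≈⟨ ⨁-pick n g ℕ.≤-refl (ℕ.>-nonZero⁻¹ n) ⟩
    when (1 ∣? n) (f 1) ∙ ⨁ n (except 1 g)    ≈⟨ ∙-cong (when-yes (1 ∣? n) (1∣ n)) (⨁-cong n rest) ⟩
    f 1 ∙ ⨁∣ n (λ k → when (2 ≤? k) (f k))    ∎
    where
    g : ℕ → Carrier
    g d = when (d ∣? n) (f d)
    rest : ∀ d → 1 ≤ d → d ≤ n → except 1 g d ≈ when (d ∣? n) (when (2 ≤? d) (f d))
    rest 1      _ _ = trans (except-≡ 1 g) (sym (when-ε (1 ∣? n) λ _ → refl))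
    rest (2+ d) _ _ = trans (except-≢ {j = 1} g λ ()) (when-cong (2+ d ∣? n) (2+ d ∣? n) id id λ _ → refl)

  ⨁∣-head : ∀ n .{{_ : NonZero n}} f → (∀ k → 2 ≤ k → k ∣ n → f k ≈ ε) → ⨁∣ n f ≈ f 1
  ⨁∣-head n f f≈ε = begin
    ⨁∣ n f                                  ≈⟨ ⨁∣-pull-1 n f ⟩
    f 1 ∙ ⨁∣ n (λ k → when (2 ≤? k) (f k))  ≈⟨ ∙-congˡ (⨁-ε n λ k _ _ → when-ε (k ∣? n) λ k∣n →
                                                 when-ε (2 ≤? k) λ 2≤k → f≈ε k 2≤k k∣n) ⟩
    f 1 ∙ ε                                 ≈⟨ identityʳ (f 1) ⟩
    f 1                                     ∎

  -- The divisors of N prime to p are those of m; the others that contribute are p times those of m.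
  ⨁∣-primeToPart : ∀ {p N m} → Prime p → .{{_ : NonZero N}} → PrimeToPart p N m →
                   (f : ℕ → Carrier) → (∀ k → 1 ≤ k → p ∣ k → f (p ℕ.* k) ≈ ε) →
                   ⨁∣ N f ≈ ⨁∣ m f ∙ ⨁∣ m (λ k → f (p ℕ.* k))
  ⨁∣-primeToPart {p} {N} {m} p-prime part f vanish = begin
    ⨁∣ N f
      ≈⟨ ⨁-partition (p ∣?_) N _ ⟩
    ⨁ N (λ d → when (¬? (p ∣? d)) (g d)) ∙ ⨁ N (λ d → when (p ∣? d) (g d))
      ≈⟨ ∙-cong prime-to-p multiples-of-p ⟩
    ⨁∣ m f ∙ ⨁∣ m (λ k → f (p ℕ.* k))
      ∎
    where
    open PrimeToPart part
    instance
      _ = divisor-nonZero m∣N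
      _ = prime⇒nonZero p-prime
      _ = quotient≢0 p∣N
    q : ℕ
    q = quotient p∣N
    N≡p*q : N ≡ p ℕ.* q
    N≡p*q = m∣n⇒n≡m*quotient p∣N
    m∣q : m ∣ q
    m∣q = coprime-divisor (Coprime-sym (prime∤⇒coprime p-prime p∤m)) (≡.subst (m ∣_) N≡p*q m∣N)
    g : ℕ → Carrier
    g d = when (d ∣? N) (f d)
    prime-to-p : ⨁ N (λ d → when (¬? (p ∣? d)) (g d)) ≈ ⨁∣ m f
    prime-to-p = trans (⨁-cong N λ d _ _ → trans (when-when (¬? (p ∣? d)) (d ∣? N))
                          (when-cong (¬? (p ∣? d) ×-dec d ∣? N) (d ∣? m)
                            (λ (p∤d , d∣N) → maximal d∣N p∤d)
                            (λ d∣m → (λ p∣d → p∤m (∣-trans p∣d d∣m)) , ∣-trans d∣m m∣N)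
                            (λ _ → refl)))
                       (⨁∣-extend f (∣⇒≤ m∣N))
    multiple : ∀ k → 1 ≤ k → when (p ℕ.* k ∣? N) (f (p ℕ.* k)) ≈ when (k ∣? m) (f (p ℕ.* k))
    multiple k 1≤k with p ∣? k
    ... | yes p∣k = trans (when-ε (p ℕ.* k ∣? N) λ _ → vanish k 1≤k p∣k)
                          (sym (when-no (k ∣? m) λ k∣m → p∤m (∣-trans p∣k k∣m)))
    ... | no  p∤k = when-cong (p ℕ.* k ∣? N) (k ∣? m)
                      (λ pk∣N → maximal (∣-trans (n∣m*n p) pk∣N) p∤k)
                      (λ k∣m → ≡.subst (_ ∣_) (≡.sym N≡p*q) (*-monoʳ-∣ p (∣-trans k∣m m∣q)))
                      (λ _ → refl)
    multiples-of-p : ⨁ N (λ d → when (p ∣? d) (g d)) ≈ ⨁∣ m (λ k → f (p ℕ.* k))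
    multiples-of-p = begin
      ⨁ N (λ d → when (p ∣? d) (g d))          ≡⟨ ≡.cong (λ n → ⨁ n (λ d → when (p ∣? d) (g d))) N≡p*q ⟩
      ⨁ (p ℕ.* q) (λ d → when (p ∣? d) (g d))  ≈⟨ ⨁-multiples p q g ⟩
      ⨁ q (λ k → g (p ℕ.* k))                  ≈⟨ ⨁-cong q (λ k 1≤k _ → multiple k 1≤k) ⟩
      ⨁ q (λ k → when (k ∣? m) (f (p ℕ.* k)))  ≈⟨ ⨁∣-extend _ (∣⇒≤ m∣q) ⟩
      ⨁∣ m (λ k → f (p ℕ.* k))                 ∎

  foldr-filter : ∀ {a p} {A : Set a} {P : A → Set p} (P? : Decidable P) (f : A → Carrier) xs →
                 foldr _∙_ ε (map f (filter P? xs)) ≈ foldr _∙_ ε (map (λ x → when (P? x) (f x)) xs)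
  foldr-filter P? f []       = refl
  foldr-filter P? f (x ∷ xs) with does (P? x)
  ... | true  = ∙-congˡ (foldr-filter P? f xs)
  ... | false = trans (foldr-filter P? f xs) (sym (identityˡ _))

  foldr-applyUpTo : ∀ n h (g : ℕ → Carrier) →
                    foldr _∙_ ε (map g (applyUpTo h n)) ≈ ⨁ n (λ d → g (h (ℕ.pred d)))
  foldr-applyUpTo zero    h g = refl
  foldr-applyUpTo (suc n) h g = trans (∙-congˡ (foldr-applyUpTo n (h ∘ suc) g))
    (sym (trans (⨁-head n _) (∙-congˡ (⨁-cong n λ { (suc d) _ _ → refl }))))

  foldr-divisorsPred : ∀ N (f : ℕ → Carrier) →
                       foldr _∙_ ε (map f (divisorsPred N)) ≈ ⨁∣ N (f ∘ ℕ.pred)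
  foldr-divisorsPred N f = trans (foldr-filter (λ k → suc k ∣? N) f (upTo N))
    (trans (foldr-applyUpTo N id _) (⨁-cong N λ { (suc d) _ _ → refl }))

  foldr-filter-divisorsPred : ∀ {p} {P : ℕ → Set p} N (P? : Decidable P) (f : ℕ → Carrier) →
    foldr _∙_ ε (map f (filter P? (divisorsPred N))) ≈ ⨁∣ N (λ d → when (P? (ℕ.pred d)) (f (ℕ.pred d)))
  foldr-filter-divisorsPred N P? f = trans (foldr-filter P? f (divisorsPred N)) (foldr-divisorsPred N _)

-- The Möbius function at p k

module ΠInt = BigOperators ℤ.*-1-commutativeMonoid

μ≡⨁μ-factor : ∀ n → μ n ≡ ΠInt.⨁ n (μ-factor n)
μ≡⨁μ-factor n = begin
  foldr ℤ._*_ 1ℤ (map (μ-factor n) (map suc (upTo n)))  ≡⟨ ≡.cong (foldr ℤ._*_ 1ℤ) (map-∘ (upTo n)) ⟨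
  foldr ℤ._*_ 1ℤ (map (μ-factor n ∘ suc) (upTo n))      ≡⟨ ΠInt.foldr-applyUpTo n id (μ-factor n ∘ suc) ⟩
  ΠInt.⨁ n (μ-factor n ∘ suc ∘ ℕ.pred)                  ≡⟨ ΠInt.⨁-cong n (λ { (suc d) _ _ → ≡.refl }) ⟩
  ΠInt.⨁ n (μ-factor n)                                 ∎
  where open ≡.≡-Reasoning

μ-factor-∤ : ∀ {n i} → i ∤ n → μ-factor n i ≡ 1ℤ
μ-factor-∤ {n} {i} i∤n with prime? i ×-dec i ∣? n
... | yes (_ , i∣n) = contradiction i∣n i∤n
... | no _          = ≡.refl

μ-factor-*-≢ : ∀ {p i} k → Prime p → i ≢ p → μ-factor (p ℕ.* k) i ≡ μ-factor k i
μ-factor-*-≢ {p} {i} k p-prime i≢p with prime? i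
... | no _        = ≡.refl
... | yes i-prime = ≡.cong₂ (λ b c → if b then (if c then 0ℤ else -1ℤ) else 1ℤ)
  (⌊⌋-⇔ (mk⇔ id id ×-⇔ coprime-∣-cancel k i⊥p) (yes i-prime ×-dec i ∣? _) (yes i-prime ×-dec i ∣? _))
  (⌊⌋-⇔ (coprime-∣-cancel k i²⊥p) (i ℕ.* i ∣? _) (i ℕ.* i ∣? _))
  where
  p∤i : p ∤ i
  p∤i p∣i = i≢p (≡.sym (prime∣prime⇒≡ p-prime i-prime p∣i))
  i⊥p : Coprime i p
  i⊥p = Coprime-sym (prime∤⇒coprime p-prime p∤i)
  i²⊥p : Coprime (i ℕ.* i) p
  i²⊥p = Coprime-sym (prime∤⇒coprime p-prime (prime∤-* p-prime p∤i p∤i))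

μ-factor-*-self-∣ : ∀ {p k} → Prime p → p ∣ k → μ-factor (p ℕ.* k) p ≡ 0ℤ
μ-factor-*-self-∣ {p} {k} p-prime p∣k with prime? p ×-dec p ∣? p ℕ.* k | p ℕ.* p ∣? p ℕ.* k
... | yes _ | yes _  = ≡.refl
... | yes _ | no p²∤ = contradiction (*-monoʳ-∣ p p∣k) p²∤
... | no ¬P | _      = contradiction (p-prime , m∣m*n k) ¬P

μ-factor-*-self-∤ : ∀ {p k} → Prime p → p ∤ k → μ-factor (p ℕ.* k) p ≡ -1ℤ
μ-factor-*-self-∤ {p} {k} p-prime p∤k with prime? p ×-dec p ∣? p ℕ.* k | p ℕ.* p ∣? p ℕ.* k
... | yes _ | yes p²∣ = contradiction (*-cancelˡ-∣ p {{prime⇒nonZero p-prime}} p²∣) p∤k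
... | yes _ | no _    = ≡.refl
... | no ¬P | _       = contradiction (p-prime , m∣m*n k) ¬P

module _ {p k} (p-prime : Prime p) .{{_ : NonZero k}} where

  private
    instance _ = prime⇒nonZero p-prime
    1≤p : 1 ≤ p
    1≤p = ℕ.>-nonZero⁻¹ p
    p≤pk : p ≤ p ℕ.* k
    p≤pk = ℕ.m≤m*n p k
    rest : ℤ
    rest = ΠInt.⨁ (p ℕ.* k) (ΠInt.except p (μ-factor k))

  -- μ (p k) and μ k share all local factors except the one at p.
  μ-*-split : μ (p ℕ.* k) ≡ μ-factor (p ℕ.* k) p ℤ.* rest
  μ-*-split = begin
    μ (p ℕ.* k)
      ≡⟨ μ≡⨁μ-factor (p ℕ.* k) ⟩
    ΠInt.⨁ (p ℕ.* k) (μ-factor (p ℕ.* k))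
      ≡⟨ ΠInt.⨁-pick (p ℕ.* k) _ 1≤p p≤pk ⟩
    μ-factor (p ℕ.* k) p ℤ.* ΠInt.⨁ (p ℕ.* k) (ΠInt.except p (μ-factor (p ℕ.* k)))
      ≡⟨ ≡.cong (μ-factor (p ℕ.* k) p ℤ.*_) (ΠInt.⨁-cong (p ℕ.* k) λ i _ _ →
           ΠInt.except-cong (λ i≢p → μ-factor-*-≢ k p-prime i≢p) i) ⟩
    μ-factor (p ℕ.* k) p ℤ.* rest
      ∎
    where open ≡.≡-Reasoning

  μ-split : μ k ≡ μ-factor k p ℤ.* rest
  μ-split = begin
    μ k                                ≡⟨ μ≡⨁μ-factor k ⟩
    ΠInt.⨁ k (μ-factor k)              ≡⟨ ΠInt.⨁-extend (μ-factor k) (ℕ.m≤n*m k p) beyond-k ⟨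
    ΠInt.⨁ (p ℕ.* k) (μ-factor k)      ≡⟨ ΠInt.⨁-pick (p ℕ.* k) _ 1≤p p≤pk ⟩
    μ-factor k p ℤ.* rest              ∎
    where
    open ≡.≡-Reasoning
    beyond-k : ∀ i → k < i → i ≤ p ℕ.* k → μ-factor k i ≡ 1ℤ
    beyond-k i k<i _ = μ-factor-∤ (>⇒∤ k<i)

  μ-*-∣ : p ∣ k → μ (p ℕ.* k) ≡ 0ℤ
  μ-*-∣ p∣k = ≡.trans μ-*-split (≡.cong (ℤ._* rest) (μ-factor-*-self-∣ p-prime p∣k))

  μ-*-∤ : p ∤ k → μ (p ℕ.* k) ≡ ℤ.- μ k
  μ-*-∤ p∤k = begin
    μ (p ℕ.* k)                     ≡⟨ μ-*-split ⟩
    μ-factor (p ℕ.* k) p ℤ.* rest   ≡⟨ ≡.cong (ℤ._* rest) (μ-factor-*-self-∤ p-prime p∤k) ⟩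
    -1ℤ ℤ.* rest                    ≡⟨ ℤ.-1*i≡-i rest ⟩
    ℤ.- rest                        ≡⟨ ≡.cong ℤ.-_ (ℤ.*-identityˡ rest) ⟨
    ℤ.- (1ℤ ℤ.* rest)               ≡⟨ ≡.cong (λ c → ℤ.- (c ℤ.* rest)) (μ-factor-∤ p∤k) ⟨
    ℤ.- (μ-factor k p ℤ.* rest)     ≡⟨ ≡.cong ℤ.-_ μ-split ⟨
    ℤ.- μ k                         ∎
    where open ≡.≡-Reasoning

-- Commutative rings: colon quotients and periods

module CommutativeRingProperties {c ℓ} (R : CommutativeRing c ℓ) where

  open CommutativeRing R
  open import Algebra.Properties.Ring ring public
  open import Algebra.Properties.Semiring.Exp semiring public
  open import Algebra.Properties.Semiring.Divisibility semiring public
    using (_∣ʳ_; _,_; _∣0; ∣ʳ-respʳ-≈; x∣ʳy⇒x∣ʳzy)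
  open import Relation.Binary.Reasoning.Setoid setoid

  open import Algebra.Properties.CommutativeSemigroup +-commutativeSemigroup public
    using () renaming (interchange to +-interchange)

  x-y+[y-z]≈x-z : ∀ x y z → (x - y) + (y - z) ≈ x - z
  x-y+[y-z]≈x-z x y z = begin
    (x - y) + (y - z)    ≈⟨ +-assoc x (- y) (y - z) ⟩
    x + (- y + (y - z))  ≈⟨ +-congˡ (+-assoc (- y) y (- z)) ⟨
    x + ((- y + y) - z)  ≈⟨ +-congˡ (+-congʳ (-‿inverseˡ y)) ⟩
    x + (0# - z)         ≈⟨ +-congˡ (+-identityˡ (- z)) ⟩
    x - z                ∎

  [x+y]-[u+v]≈[x-u]+[y-v] : ∀ x y u v → (x + y) - (u + v) ≈ (x - u) + (y - v)
  [x+y]-[u+v]≈[x-u]+[y-v] x y u v = begin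
    (x + y) - (u + v)      ≈⟨ +-congˡ (-‿+-comm u v) ⟨
    (x + y) + (- u - v)    ≈⟨ +-interchange x y (- u) (- v) ⟩
    (x - u) + (y - v)      ∎

  xy-uv≈[x-u]y+u[y-v] : ∀ x y u v → x * y - u * v ≈ (x - u) * y + u * (y - v)
  xy-uv≈[x-u]y+u[y-v] x y u v = begin
    x * y - u * v                          ≈⟨ x-y+[y-z]≈x-z (x * y) (u * y) (u * v) ⟨
    (x * y - u * y) + (u * y - u * v)      ≈⟨ +-cong ([y-z]x≈yx-zx y x u) (x[y-z]≈xy-xz u y v) ⟨
    (x - u) * y + u * (y - v)              ∎

  [x-y][zw]≈[xz]w-w[yz] : ∀ x y z w → (x - y) * (z * w) ≈ (x * z) * w - w * (y * z)
  [x-y][zw]≈[xz]w-w[yz] x y z w = trans ([y-z]x≈yx-zx (z * w) x y)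
    (+-cong (sym (*-assoc x z w)) (-‿cong (*-leftRotate y z w)))
    where open import Algebra.Properties.CommutativeSemigroup *-commutativeSemigroup
            using () renaming (x∙yz≈z∙xy to *-leftRotate)

  ∣ʳ-+ : ∀ {x y z} → x ∣ʳ y → x ∣ʳ z → x ∣ʳ y + z
  ∣ʳ-+ {x} (q , qx≈y) (r , rx≈z) = q + r , trans (distribʳ x q r) (+-cong qx≈y rx≈z)

  ∣ʳ-neg : ∀ {x y} → x ∣ʳ y → x ∣ʳ - y
  ∣ʳ-neg {x} (q , qx≈y) = - q , trans (sym (-‿distribˡ-* q x)) (-‿cong qx≈y)

  ∣ʳ-- : ∀ {x y z} → x ∣ʳ y → x ∣ʳ z → x ∣ʳ y - z
  ∣ʳ-- x∣y x∣z = ∣ʳ-+ x∣y (∣ʳ-neg x∣z)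

  ∣ʳ-zero : ∀ {x y} → y ≈ 0# → x ∣ʳ y
  ∣ʳ-zero {x} y≈0 = ∣ʳ-respʳ-≈ (sym y≈0) (x ∣0)

  module Colon (M C : Carrier) where

    open import Algebra.Properties.CommutativeSemigroup *-commutativeSemigroup
      using (x∙yz≈y∙xz; x∙yz≈z∙xy)

    -- x ≋ y : x ≡ y modulo the colon ideal (M : C) = {z | M ∣ C z}.
    infix 4 _≋_
    record _≋_ (x y : Carrier) : Set (c ⊔ ℓ) where
      constructor colon
      field colon-∣ : M ∣ʳ C * (x - y)
    open _≋_ public

    private
      ∣C*-resp : ∀ {x y} → x ≈ y → M ∣ʳ C * x → M ∣ʳ C * y
      ∣C*-resp x≈y = ∣ʳ-respʳ-≈ (*-congˡ x≈y)

    x-0≈x : ∀ x → x - 0# ≈ x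
    x-0≈x x = trans (+-congˡ -0#≈0#) (+-identityʳ x)

    ∣⇒≋0 : ∀ {x} → M ∣ʳ C * x → x ≋ 0#
    ∣⇒≋0 {x} M∣Cx = colon (∣C*-resp (sym (x-0≈x x)) M∣Cx)

    ≋0⇒∣ : ∀ {x} → x ≋ 0# → M ∣ʳ C * x
    ≋0⇒∣ {x} (colon M∣C[x-0]) = ∣C*-resp (x-0≈x x) M∣C[x-0]

    ≈⇒≋ : ∀ {x y} → x ≈ y → x ≋ y
    ≈⇒≋ x≈y = colon (∣ʳ-zero (trans (*-congˡ (x≈y⇒x∙y⁻¹≈ε x≈y)) (zeroʳ C)))

    ≋-sym : ∀ {x y} → x ≋ y → y ≋ x
    ≋-sym {x} {y} (colon x≋y) =
      colon (∣C*-resp (⁻¹-anti-homo‿- x y) (∣ʳ-respʳ-≈ (-‿distribʳ-* C (x - y)) (∣ʳ-neg x≋y)))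

    ≋-trans : ∀ {x y z} → x ≋ y → y ≋ z → x ≋ z
    ≋-trans {x} {y} {z} (colon x≋y) (colon y≋z) =
      colon (∣C*-resp (x-y+[y-z]≈x-z x y z)
                      (∣ʳ-respʳ-≈ (sym (distribˡ C (x - y) (y - z))) (∣ʳ-+ x≋y y≋z)))

    ≋-+-cong : ∀ {x y u v} → x ≋ y → u ≋ v → x + u ≋ y + v
    ≋-+-cong {x} {y} {u} {v} (colon x≋y) (colon u≋v) =
      colon (∣C*-resp (sym ([x+y]-[u+v]≈[x-u]+[y-v] x u y v))
                      (∣ʳ-respʳ-≈ (sym (distribˡ C (x - y) (u - v))) (∣ʳ-+ x≋y u≋v)))

    ≋-*-cong : ∀ {x y u v} → x ≋ y → u ≋ v → x * u ≋ y * v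
    ≋-*-cong {x} {y} {u} {v} (colon x≋y) (colon u≋v) =
      colon (∣C*-resp (sym (xy-uv≈[x-u]y+u[y-v] x u y v))
                      (∣ʳ-respʳ-≈ rearrange (∣ʳ-+ (x∣ʳy⇒x∣ʳzy u x≋y) (x∣ʳy⇒x∣ʳzy y u≋v))))
      where
      rearrange : u * (C * (x - y)) + y * (C * (u - v)) ≈ C * ((x - y) * u + y * (u - v))
      rearrange = begin
        u * (C * (x - y)) + y * (C * (u - v))  ≈⟨ +-cong (x∙yz≈z∙xy C (x - y) u) (x∙yz≈y∙xz C y (u - v)) ⟨
        C * ((x - y) * u) + C * (y * (u - v))  ≈⟨ distribˡ C ((x - y) * u) (y * (u - v)) ⟨
        C * ((x - y) * u + y * (u - v))        ∎

    ≋--‿cong : ∀ {x y} → x ≋ y → - x ≋ - y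
    ≋--‿cong {x} {y} (colon x≋y) =
      colon (∣C*-resp (sym (-‿+-comm x (- y))) (∣ʳ-respʳ-≈ (-‿distribʳ-* C (x - y)) (∣ʳ-neg x≋y)))

    quotientRing : CommutativeRing c (c ⊔ ℓ)
    quotientRing = record
      { Carrier = Carrier ; _≈_ = _≋_ ; _+_ = _+_ ; _*_ = _*_ ; -_ = -_ ; 0# = 0# ; 1# = 1#
      ; isCommutativeRing = record
        { isRing = record
          { +-isAbelianGroup = record
            { isGroup = record
              { isMonoid = record
                { isSemigroup = record
                  { isMagma = record
                    { isEquivalence = record { refl = ≈⇒≋ refl ; sym = ≋-sym ; trans = ≋-trans }
                    ; ∙-cong = ≋-+-cong }
                  ; assoc = λ x y z → ≈⇒≋ (+-assoc x y z) }
                ; identity = (λ x → ≈⇒≋ (+-identityˡ x)) , (λ x → ≈⇒≋ (+-identityʳ x)) }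
              ; inverse = (λ x → ≈⇒≋ (-‿inverseˡ x)) , (λ x → ≈⇒≋ (-‿inverseʳ x))
              ; ⁻¹-cong = ≋--‿cong }
            ; comm = λ x y → ≈⇒≋ (+-comm x y) }
          ; *-cong = ≋-*-cong
          ; *-assoc = λ x y z → ≈⇒≋ (*-assoc x y z)
          ; *-identity = (λ x → ≈⇒≋ (*-identityˡ x)) , (λ x → ≈⇒≋ (*-identityʳ x))
          ; distrib = (λ x y z → ≈⇒≋ (distribˡ x y z)) , (λ x y z → ≈⇒≋ (distribʳ x y z)) }
        ; *-comm = λ x y → ≈⇒≋ (*-comm x y) } }

  geometric : Carrier → ℕ → Carrier
  geometric u zero    = 0#
  geometric u (suc n) = 1# + u * geometric u n

  geometric*[u-1] : ∀ u n → geometric u n * (u - 1#) ≈ u ^ n - 1#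
  geometric*[u-1] u zero    = trans (zeroˡ (u - 1#)) (sym (-‿inverseʳ 1#))
  geometric*[u-1] u (suc n) = begin
    (1# + u * geometric u n) * (u - 1#)              ≈⟨ distribʳ (u - 1#) 1# (u * geometric u n) ⟩
    1# * (u - 1#) + (u * geometric u n) * (u - 1#)   ≈⟨ +-cong (*-identityˡ (u - 1#)) (*-assoc u _ _) ⟩
    (u - 1#) + u * (geometric u n * (u - 1#))        ≈⟨ +-congˡ (*-congˡ (geometric*[u-1] u n)) ⟩
    (u - 1#) + u * (u ^ n - 1#)                      ≈⟨ +-comm (u - 1#) _ ⟩
    u * (u ^ n - 1#) + (u - 1#)                      ≈⟨ +-congʳ (x[y-z]≈xy-xz u (u ^ n) 1#) ⟩
    (u * u ^ n - u * 1#) + (u - 1#)                  ≈⟨ +-congʳ (+-congˡ (-‿cong (*-identityʳ u))) ⟩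
    (u * u ^ n - u) + (u - 1#)                       ≈⟨ x-y+[y-z]≈x-z (u * u ^ n) u 1# ⟩
    u * u ^ n - 1#                                   ∎

  ^-1-+ : ∀ u m n → u ^ (m ℕ.+ n) - 1# ≈ u ^ m * (u ^ n - 1#) + (u ^ m - 1#)
  ^-1-+ u m n = begin
    u ^ (m ℕ.+ n) - 1#                          ≈⟨ +-congʳ (^-homo-* u m n) ⟩
    u ^ m * u ^ n - 1#                          ≈⟨ x-y+[y-z]≈x-z (u ^ m * u ^ n) (u ^ m) 1# ⟨
    (u ^ m * u ^ n - u ^ m) + (u ^ m - 1#)      ≈⟨ +-congʳ (+-congˡ (-‿cong (*-identityʳ (u ^ m)))) ⟨
    (u ^ m * u ^ n - u ^ m * 1#) + (u ^ m - 1#) ≈⟨ +-congʳ (x[y-z]≈xy-xz (u ^ m) (u ^ n) 1#) ⟨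
    u ^ m * (u ^ n - 1#) + (u ^ m - 1#)         ∎

  u^n-1∣u^[n*t]-1 : ∀ u n t → u ^ n - 1# ∣ʳ u ^ (n ℕ.* t) - 1#
  u^n-1∣u^[n*t]-1 u n t =
    geometric (u ^ n) t , trans (geometric*[u-1] (u ^ n) t) (+-congʳ (^-assocʳ u n t))

  module Periods (u M x : Carrier) where

    record IsPeriod (g : ℕ) : Set (c ⊔ ℓ) where
      constructor period
      field period-∣ : M ∣ʳ (u ^ g - 1#) * x
    open IsPeriod public

    period-* : ∀ {n} t → IsPeriod n → IsPeriod (t ℕ.* n)
    period-* {n} t (period n-period) with u^n-1∣u^[n*t]-1 u n t
    ... | G , G*[u^n-1]≈u^nt-1 = period (∣ʳ-respʳ-≈ (begin
      G * ((u ^ n - 1#) * x)   ≈⟨ *-assoc G _ x ⟨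
      (G * (u ^ n - 1#)) * x   ≈⟨ *-congʳ G*[u^n-1]≈u^nt-1 ⟩
      (u ^ (n ℕ.* t) - 1#) * x ≈⟨ *-congʳ (+-congʳ (^-congʳ u (ℕ.*-comm n t))) ⟩
      (u ^ (t ℕ.* n) - 1#) * x ∎) (x∣ʳy⇒x∣ʳzy G n-period))

    period-∸ : ∀ {a b} → IsPeriod (a ℕ.+ b) → IsPeriod b → IsPeriod a
    period-∸ {a} {b} (period a+b-period) (period b-period) = period (∣ʳ-respʳ-≈ (begin
      (u ^ (a ℕ.+ b) - 1#) * x - u ^ a * ((u ^ b - 1#) * x)
        ≈⟨ +-cong (*-congʳ (^-1-+ u a b)) (-‿cong (sym (*-assoc (u ^ a) _ x))) ⟩
      (y + (u ^ a - 1#)) * x - y * x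
        ≈⟨ +-congʳ (distribʳ x y (u ^ a - 1#)) ⟩
      y * x + (u ^ a - 1#) * x - y * x
        ≈⟨ xyx⁻¹≈y (y * x) ((u ^ a - 1#) * x) ⟩
      (u ^ a - 1#) * x ∎) (∣ʳ-- a+b-period (x∣ʳy⇒x∣ʳzy (u ^ a) b-period)))
      where
      y : Carrier
      y = u ^ a * (u ^ b - 1#)

-- The ring ℤ[q]

module Polynomials where

  open ≡ using (refl; cong; cong₂)

  infix 4 _≃_

  -- A record rather than the function type _≈ₚ_, so that both sides can be inferred.
  record _≃_ (P Q : Poly) : Set where
    constructor coeffwise
    field coeff-≡ : P ≈ₚ Q
  open _≃_ public

  ≃-isEquivalence : IsEquivalence _≃_
  ≃-isEquivalence = record
    { refl  = coeffwise λ _ → refl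
    ; sym   = λ P≃Q → coeffwise λ k → ≡.sym (coeff-≡ P≃Q k)
    ; trans = λ P≃Q Q≃R → coeffwise λ k → ≡.trans (coeff-≡ P≃Q k) (coeff-≡ Q≃R k)
    }

  ≃-setoid : Setoid 0ℓ 0ℓ
  ≃-setoid = record { isEquivalence = ≃-isEquivalence }

  open IsEquivalence ≃-isEquivalence
    using () renaming (refl to ≃-refl; sym to ≃-sym; trans to ≃-trans)

  import Relation.Binary.Reasoning.Setoid as SetoidReasoning
  module ≃-Reasoning = SetoidReasoning ≃-setoid

  shift : Poly → Poly
  shift P = 0ℤ ∷ P

  coeff-+ : ∀ P Q k → coeff (P +ₚ Q) k ≡ coeff P k ℤ.+ coeff Q k
  coeff-+ []      Q       k       = ≡.sym (ℤ.+-identityˡ _)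
  coeff-+ (a ∷ P) []      k       = ≡.sym (ℤ.+-identityʳ _)
  coeff-+ (a ∷ P) (b ∷ Q) zero    = refl
  coeff-+ (a ∷ P) (b ∷ Q) (suc k) = coeff-+ P Q k

  coeff-*ₛ : ∀ c P k → coeff (c *ₛ P) k ≡ c ℤ.* coeff P k
  coeff-*ₛ c []      k       = ≡.sym (ℤ.*-zeroʳ c)
  coeff-*ₛ c (a ∷ P) zero    = refl
  coeff-*ₛ c (a ∷ P) (suc k) = coeff-*ₛ c P k

  coeff-neg : ∀ P k → coeff (-ₚ P) k ≡ ℤ.- coeff P k
  coeff-neg []      k       = refl
  coeff-neg (a ∷ P) zero    = refl
  coeff-neg (a ∷ P) (suc k) = coeff-neg P k

  +-cong : ∀ {P P' Q Q'} → P ≃ P' → Q ≃ Q' → P +ₚ Q ≃ P' +ₚ Q'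
  +-cong {P} {P'} {Q} {Q'} P≃P' Q≃Q' = coeffwise go
    where
    go : ∀ k → coeff (P +ₚ Q) k ≡ coeff (P' +ₚ Q') k
    go k rewrite coeff-+ P Q k | coeff-+ P' Q' k = cong₂ ℤ._+_ (coeff-≡ P≃P' k) (coeff-≡ Q≃Q' k)

  +-assoc : ∀ P Q R → (P +ₚ Q) +ₚ R ≃ P +ₚ (Q +ₚ R)
  +-assoc P Q R = coeffwise go
    where
    go : ∀ k → coeff ((P +ₚ Q) +ₚ R) k ≡ coeff (P +ₚ (Q +ₚ R)) k
    go k rewrite coeff-+ (P +ₚ Q) R k | coeff-+ P Q k | coeff-+ P (Q +ₚ R) k | coeff-+ Q R k =
      ℤ.+-assoc (coeff P k) (coeff Q k) (coeff R k)

  +-comm : ∀ P Q → P +ₚ Q ≃ Q +ₚ P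
  +-comm P Q = coeffwise go
    where
    go : ∀ k → coeff (P +ₚ Q) k ≡ coeff (Q +ₚ P) k
    go k rewrite coeff-+ P Q k | coeff-+ Q P k = ℤ.+-comm (coeff P k) (coeff Q k)

  +-identityˡ : ∀ P → [] +ₚ P ≃ P
  +-identityˡ P = ≃-refl

  +-identityʳ : ∀ P → P +ₚ [] ≃ P
  +-identityʳ P = coeffwise λ k → ≡.trans (coeff-+ P [] k) (ℤ.+-identityʳ (coeff P k))

  -‿cong : ∀ {P P'} → P ≃ P' → -ₚ P ≃ -ₚ P'
  -‿cong {P} {P'} P≃P' = coeffwise go
    where
    go : ∀ k → coeff (-ₚ P) k ≡ coeff (-ₚ P') k
    go k rewrite coeff-neg P k | coeff-neg P' k = cong ℤ.-_ (coeff-≡ P≃P' k)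

  -‿inverseʳ : ∀ P → P +ₚ (-ₚ P) ≃ []
  -‿inverseʳ P = coeffwise go
    where
    go : ∀ k → coeff (P +ₚ (-ₚ P)) k ≡ 0ℤ
    go k rewrite coeff-+ P (-ₚ P) k | coeff-neg P k = ℤ.+-inverseʳ (coeff P k)

  -‿inverseˡ : ∀ P → (-ₚ P) +ₚ P ≃ []
  -‿inverseˡ P = ≃-trans (+-comm (-ₚ P) P) (-‿inverseʳ P)

  *ₛ-cong : ∀ c {P P'} → P ≃ P' → c *ₛ P ≃ c *ₛ P'
  *ₛ-cong c {P} {P'} P≃P' = coeffwise go
    where
    go : ∀ k → coeff (c *ₛ P) k ≡ coeff (c *ₛ P') k
    go k rewrite coeff-*ₛ c P k | coeff-*ₛ c P' k = cong (c ℤ.*_) (coeff-≡ P≃P' k)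

  *ₛ-distrib-+ : ∀ c P Q → c *ₛ (P +ₚ Q) ≃ c *ₛ P +ₚ c *ₛ Q
  *ₛ-distrib-+ c P Q = coeffwise go
    where
    go : ∀ k → coeff (c *ₛ (P +ₚ Q)) k ≡ coeff (c *ₛ P +ₚ c *ₛ Q) k
    go k rewrite coeff-*ₛ c (P +ₚ Q) k | coeff-+ P Q k | coeff-+ (c *ₛ P) (c *ₛ Q) k
               | coeff-*ₛ c P k | coeff-*ₛ c Q k = ℤ.*-distribˡ-+ c (coeff P k) (coeff Q k)

  *ₛ-assoc : ∀ c d P → c *ₛ (d *ₛ P) ≃ (c ℤ.* d) *ₛ P
  *ₛ-assoc c d P = coeffwise go
    where
    go : ∀ k → coeff (c *ₛ (d *ₛ P)) k ≡ coeff ((c ℤ.* d) *ₛ P) k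
    go k rewrite coeff-*ₛ c (d *ₛ P) k | coeff-*ₛ d P k | coeff-*ₛ (c ℤ.* d) P k =
      ≡.sym (ℤ.*-assoc c d (coeff P k))

  *ₛ-zeroˡ : ∀ P → 0ℤ *ₛ P ≃ []
  *ₛ-zeroˡ P = coeffwise (coeff-*ₛ 0ℤ P)

  *ₛ-identityˡ : ∀ P → 1ℤ *ₛ P ≃ P
  *ₛ-identityˡ P = coeffwise λ k → ≡.trans (coeff-*ₛ 1ℤ P k) (ℤ.*-identityˡ (coeff P k))

  *ₛ-neg : ∀ c P → ℤ.- c *ₛ P ≃ c *ₛ (-ₚ P)
  *ₛ-neg c P = coeffwise go
    where
    go : ∀ k → coeff (ℤ.- c *ₛ P) k ≡ coeff (c *ₛ (-ₚ P)) k
    go k rewrite coeff-*ₛ (ℤ.- c) P k | coeff-*ₛ c (-ₚ P) k | coeff-neg P k =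
      ≡.trans (≡.sym (ℤ.neg-distribˡ-* c (coeff P k))) (ℤ.neg-distribʳ-* c (coeff P k))

  ∷-cong : ∀ {a b P Q} → a ≡ b → P ≃ Q → a ∷ P ≃ b ∷ Q
  ∷-cong a≡b P≃Q = coeffwise λ { zero → a≡b ; (suc k) → coeff-≡ P≃Q k }

  shift-cong : ∀ {P Q} → P ≃ Q → shift P ≃ shift Q
  shift-cong = ∷-cong refl

  ∷-injectiveʳ : ∀ {a b P Q} → a ∷ P ≃ b ∷ Q → P ≃ Q
  ∷-injectiveʳ a∷P≃b∷Q = coeffwise λ k → coeff-≡ a∷P≃b∷Q (suc k)

  ∷-zero : ∀ {a P} → a ∷ P ≃ [] → P ≃ []
  ∷-zero a∷P≃0 = coeffwise λ k → coeff-≡ a∷P≃0 (suc k)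

  shift-zero : ∀ {P} → P ≃ [] → shift P ≃ []
  shift-zero P≃0 = coeffwise λ { zero → refl ; (suc k) → coeff-≡ P≃0 k }

  *ₛ-shift : ∀ c P → c *ₛ shift P ≃ shift (c *ₛ P)
  *ₛ-shift c P = ∷-cong (ℤ.*-zeroʳ c) ≃-refl

  +-commutativeMonoid : CommutativeMonoid 0ℓ 0ℓ
  +-commutativeMonoid = record
    { Carrier = Poly ; _≈_ = _≃_ ; _∙_ = _+ₚ_ ; ε = []
    ; isCommutativeMonoid = record
      { isMonoid = record
        { isSemigroup = record
          { isMagma = record { isEquivalence = ≃-isEquivalence ; ∙-cong = +-cong }
          ; assoc = +-assoc }
        ; identity = +-identityˡ , +-identityʳ }
      ; comm = +-comm } }

  open CommutativeSemigroupProperties (CommutativeMonoid.commutativeSemigroup +-commutativeMonoid)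
    using () renaming (x∙yz≈y∙xz to +-leftComm; interchange to +-interchange)

  *-zeroʳ : ∀ P → P *ₚ [] ≃ []
  *-zeroʳ []      = ≃-refl
  *-zeroʳ (a ∷ P) = shift-zero (*-zeroʳ P)

  *-congˡ : ∀ P {Q Q'} → Q ≃ Q' → P *ₚ Q ≃ P *ₚ Q'
  *-congˡ []      Q≃Q' = ≃-refl
  *-congˡ (a ∷ P) Q≃Q' = +-cong (*ₛ-cong a Q≃Q') (shift-cong (*-congˡ P Q≃Q'))

  *-∷ʳ : ∀ P b Q → P *ₚ (b ∷ Q) ≃ b *ₛ P +ₚ shift (P *ₚ Q)
  *-∷ʳ []      b Q = coeffwise λ { zero → refl ; (suc k) → refl }
  *-∷ʳ (a ∷ P) b Q = ∷-cong (cong (ℤ._+ 0ℤ) (ℤ.*-comm a b)) (begin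
    a *ₛ Q +ₚ P *ₚ (b ∷ Q)              ≈⟨ +-cong (≃-refl {a *ₛ Q}) (*-∷ʳ P b Q) ⟩
    a *ₛ Q +ₚ (b *ₛ P +ₚ shift (P *ₚ Q)) ≈⟨ +-leftComm (a *ₛ Q) (b *ₛ P) _ ⟩
    b *ₛ P +ₚ (a *ₛ Q +ₚ shift (P *ₚ Q)) ∎)
    where open ≃-Reasoning

  *-comm : ∀ P Q → P *ₚ Q ≃ Q *ₚ P
  *-comm []      Q = ≃-sym (*-zeroʳ Q)
  *-comm (a ∷ P) Q = ≃-trans (+-cong (≃-refl {a *ₛ Q}) (shift-cong (*-comm P Q))) (≃-sym (*-∷ʳ Q a P))

  *-cong : ∀ {P P' Q Q'} → P ≃ P' → Q ≃ Q' → P *ₚ Q ≃ P' *ₚ Q'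
  *-cong {P} {P'} {Q} {Q'} P≃P' Q≃Q' = begin
    P *ₚ Q   ≈⟨ *-comm P Q ⟩
    Q *ₚ P   ≈⟨ *-congˡ Q P≃P' ⟩
    Q *ₚ P'  ≈⟨ *-comm Q P' ⟩
    P' *ₚ Q  ≈⟨ *-congˡ P' Q≃Q' ⟩
    P' *ₚ Q' ∎
    where open ≃-Reasoning

  *-distribˡ-+ : ∀ P Q R → P *ₚ (Q +ₚ R) ≃ P *ₚ Q +ₚ P *ₚ R
  *-distribˡ-+ []      Q R = ≃-refl
  *-distribˡ-+ (a ∷ P) Q R = begin
    a *ₛ (Q +ₚ R) +ₚ shift (P *ₚ (Q +ₚ R))
      ≈⟨ +-cong (*ₛ-distrib-+ a Q R) (shift-cong (*-distribˡ-+ P Q R)) ⟩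
    (a *ₛ Q +ₚ a *ₛ R) +ₚ (shift (P *ₚ Q) +ₚ shift (P *ₚ R))
      ≈⟨ +-interchange (a *ₛ Q) (a *ₛ R) _ _ ⟩
    (a *ₛ Q +ₚ shift (P *ₚ Q)) +ₚ (a *ₛ R +ₚ shift (P *ₚ R)) ∎
    where open ≃-Reasoning

  *-distribʳ-+ : ∀ P Q R → (Q +ₚ R) *ₚ P ≃ Q *ₚ P +ₚ R *ₚ P
  *-distribʳ-+ P Q R = begin
    (Q +ₚ R) *ₚ P      ≈⟨ *-comm (Q +ₚ R) P ⟩
    P *ₚ (Q +ₚ R)      ≈⟨ *-distribˡ-+ P Q R ⟩
    P *ₚ Q +ₚ P *ₚ R   ≈⟨ +-cong (*-comm P Q) (*-comm P R) ⟩
    Q *ₚ P +ₚ R *ₚ P   ∎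
    where open ≃-Reasoning

  *ₛ-*ˡ : ∀ c P Q → (c *ₛ P) *ₚ Q ≃ c *ₛ (P *ₚ Q)
  *ₛ-*ˡ c []      Q = ≃-refl
  *ₛ-*ˡ c (a ∷ P) Q = begin
    (c ℤ.* a) *ₛ Q +ₚ shift ((c *ₛ P) *ₚ Q) ≈⟨ +-cong (≃-sym (*ₛ-assoc c a Q)) (shift-cong (*ₛ-*ˡ c P Q)) ⟩
    c *ₛ (a *ₛ Q) +ₚ shift (c *ₛ (P *ₚ Q))  ≈⟨ +-cong ≃-refl (≃-sym (*ₛ-shift c (P *ₚ Q))) ⟩
    c *ₛ (a *ₛ Q) +ₚ c *ₛ shift (P *ₚ Q)    ≈⟨ ≃-sym (*ₛ-distrib-+ c (a *ₛ Q) (shift (P *ₚ Q))) ⟩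
    c *ₛ (a *ₛ Q +ₚ shift (P *ₚ Q))         ∎
    where open ≃-Reasoning

  shift-*ˡ : ∀ P Q → shift P *ₚ Q ≃ shift (P *ₚ Q)
  shift-*ˡ P Q = +-cong (*ₛ-zeroˡ Q) (≃-refl {shift (P *ₚ Q)})

  *-assoc : ∀ P Q R → (P *ₚ Q) *ₚ R ≃ P *ₚ (Q *ₚ R)
  *-assoc []      Q R = ≃-refl
  *-assoc (a ∷ P) Q R = begin
    (a *ₛ Q +ₚ shift (P *ₚ Q)) *ₚ R          ≈⟨ *-distribʳ-+ R (a *ₛ Q) _ ⟩
    (a *ₛ Q) *ₚ R +ₚ shift (P *ₚ Q) *ₚ R     ≈⟨ +-cong (*ₛ-*ˡ a Q R) (shift-*ˡ (P *ₚ Q) R) ⟩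
    a *ₛ (Q *ₚ R) +ₚ shift ((P *ₚ Q) *ₚ R)   ≈⟨ +-cong ≃-refl (shift-cong (*-assoc P Q R)) ⟩
    a *ₛ (Q *ₚ R) +ₚ shift (P *ₚ (Q *ₚ R))   ∎
    where open ≃-Reasoning

  *-identityˡ : ∀ P → oneₚ *ₚ P ≃ P
  *-identityˡ P = ≃-trans (+-cong (*ₛ-identityˡ P) (shift-zero {[]} ≃-refl)) (+-identityʳ P)

  *-identityʳ : ∀ P → P *ₚ oneₚ ≃ P
  *-identityʳ P = ≃-trans (*-comm P oneₚ) (*-identityˡ P)

  ℤ[q] : CommutativeRing 0ℓ 0ℓ
  ℤ[q] = record
    { Carrier = Poly ; _≈_ = _≃_ ; _+_ = _+ₚ_ ; _*_ = _*ₚ_ ; -_ = -ₚ_ ; 0# = [] ; 1# = oneₚ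
    ; isCommutativeRing = record
      { isRing = record
        { +-isAbelianGroup = record
          { isGroup = record
            { isMonoid = CommutativeMonoid.isMonoid +-commutativeMonoid
            ; inverse = -‿inverseˡ , -‿inverseʳ
            ; ⁻¹-cong = -‿cong }
          ; comm = +-comm }
        ; *-cong = *-cong
        ; *-assoc = *-assoc
        ; *-identity = *-identityˡ , *-identityʳ
        ; distrib = (λ P Q R → *-distribˡ-+ P Q R) , (λ P Q R → *-distribʳ-+ P Q R) }
      ; *-comm = *-comm } }

open Polynomials
  using ( _≃_; coeffwise; coeff-≡; module ≃-Reasoning; ℤ[q]; shift; shift-zero; ∷-cong; ∷-injectiveʳ; ∷-zero
        ; *ₛ-cong; *ₛ-distrib-+; *ₛ-*ˡ; *ₛ-zeroˡ; *ₛ-identityˡ; *ₛ-neg )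
open CommutativeRing ℤ[q]
open CommutativeRingProperties ℤ[q]
open CommutativeSemigroupProperties *-commutativeSemigroup using (x∙yz≈z∙yx)

X : Poly
X = 0ℤ ∷ 1ℤ ∷ []

[_]ₚ : ℤ → Poly
[ c ]ₚ = c ∷ []

[]ₚ-zero : ∀ {c} → c ≡ 0ℤ → [ c ]ₚ ≃ []
[]ₚ-zero c≡0 = coeffwise λ { zero → c≡0 ; (suc k) → ≡.refl }

X*P≃shiftP : ∀ P → X *ₚ P ≃ shift P
X*P≃shiftP P = begin
  0ℤ *ₛ P +ₚ shift (1ℤ *ₛ P +ₚ shift [])  ≈⟨ +-cong (*ₛ-zeroˡ P) (∷-cong ≡.refl 1P+0≃P) ⟩
  [] +ₚ shift P                           ≈⟨ +-identityˡ (shift P) ⟩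
  shift P                                 ∎
  where
  open ≃-Reasoning
  1P+0≃P : 1ℤ *ₛ P +ₚ shift [] ≃ P
  1P+0≃P = trans (+-cong (*ₛ-identityˡ P) (shift-zero refl)) (+-identityʳ P)

∷≃[c]+X* : ∀ c P → c ∷ P ≃ [ c ]ₚ +ₚ X *ₚ P
∷≃[c]+X* c P = sym (trans (+-congˡ {x = [ c ]ₚ} (X*P≃shiftP P)) (∷-cong (ℤ.+-identityʳ c) refl))

replicate0++≃X^* : ∀ j P → replicate j 0ℤ ++ P ≃ X ^ j *ₚ P
replicate0++≃X^* zero    P = sym (*-identityˡ P)
replicate0++≃X^* (suc j) P = begin
  0ℤ ∷ (replicate j 0ℤ ++ P)  ≈⟨ ∷-cong ≡.refl (replicate0++≃X^* j P) ⟩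
  shift (X ^ j *ₚ P)          ≈⟨ X*P≃shiftP _ ⟨
  X *ₚ (X ^ j *ₚ P)           ≈⟨ *-assoc X (X ^ j) P ⟨
  X ^ suc j *ₚ P              ∎
  where open ≃-Reasoning

*ₛ≃[c]* : ∀ c P → c *ₛ P ≃ [ c ]ₚ *ₚ P
*ₛ≃[c]* c P = sym (trans (+-congˡ (shift-zero refl)) (+-identityʳ (c *ₛ P)))

*ₛ-*ʳ : ∀ c P Q → P *ₚ (c *ₛ Q) ≃ c *ₛ (P *ₚ Q)
*ₛ-*ʳ c P Q = trans (*-comm P (c *ₛ Q)) (trans (*ₛ-*ˡ c Q P) (*ₛ-cong c (*-comm Q P)))

[n]q≃geometric : ∀ n → [ n ]q ≃ geometric X n
[n]q≃geometric zero    = refl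
[n]q≃geometric (suc n) =
  trans (∷≃[c]+X* 1ℤ [ n ]q) (+-congˡ {x = oneₚ} (*-congˡ {x = X} ([n]q≃geometric n)))

X^n-1≃[n]q*[X-1] : ∀ n → X ^ n -ₚ oneₚ ≃ [ n ]q *ₚ (X -ₚ oneₚ)
X^n-1≃[n]q*[X-1] n = sym (trans (*-congʳ ([n]q≃geometric n)) (geometric*[u-1] X n))

*-cancel-nonzero-constant : ∀ {c} R → c ≢ 0ℤ → ∀ P → P *ₚ (c ∷ R) ≃ [] → P ≃ []
*-cancel-nonzero-constant     R c≢0 []      _       = refl
*-cancel-nonzero-constant {c} R c≢0 (a ∷ P) aP*cR≃0 = coeffwise λ { zero → a≡0 ; (suc k) → coeff-≡ P≃0 k }
  where
  open ≃-Reasoning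
  a≡0 : a ≡ 0ℤ
  a≡0 with ℤ.i*j≡0⇒i≡0∨j≡0 a (≡.trans (≡.sym (ℤ.+-identityʳ (a ℤ.* c))) (coeff-≡ aP*cR≃0 0))
  ... | inj₁ a≡0 = a≡0
  ... | inj₂ c≡0 = contradiction c≡0 c≢0
  P≃0 : P ≃ []
  P≃0 = *-cancel-nonzero-constant R c≢0 P (begin
    P *ₚ (c ∷ R)            ≈⟨ +-identityˡ _ ⟨
    [] +ₚ P *ₚ (c ∷ R)      ≈⟨ +-congʳ (≡.subst (λ a → a *ₛ R ≃ []) (≡.sym a≡0) (*ₛ-zeroˡ R)) ⟨
    a *ₛ R +ₚ P *ₚ (c ∷ R)  ≈⟨ ∷-zero aP*cR≃0 ⟩
    []                      ∎)

X-1-cancel : ∀ {P Q} → P *ₚ (X -ₚ oneₚ) ≃ Q *ₚ (X -ₚ oneₚ) → P ≃ Q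
X-1-cancel {P} {Q} P[X-1]≃Q[X-1] = x∙y⁻¹≈ε⇒x≈y P Q
  (*-cancel-nonzero-constant [ 1ℤ ]ₚ (λ ()) (P -ₚ Q)
    (trans ([y-z]x≈yx-zx (X -ₚ oneₚ) P Q) (x≈y⇒x∙y⁻¹≈ε P[X-1]≃Q[X-1])))

X^1≃X : X ^ 1 ≃ X
X^1≃X = *-identityʳ X

[n]q∣⇒period-1 : ∀ n {P} → [ n ]q ∣ₚ P → Periods.IsPeriod X (X ^ n -ₚ oneₚ) P 1
[n]q∣⇒period-1 n {P} (R , P≈[n]R) = Periods.period (R , (begin
  R *ₚ (X ^ n -ₚ oneₚ)                ≈⟨ *-congˡ {x = R} (X^n-1≃[n]q*[X-1] n) ⟩
  R *ₚ ([ n ]q *ₚ (X -ₚ oneₚ))        ≈⟨ x∙yz≈z∙yx R [ n ]q (X -ₚ oneₚ) ⟩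
  (X -ₚ oneₚ) *ₚ ([ n ]q *ₚ R)        ≈⟨ *-cong (+-congʳ {x = -ₚ oneₚ} X^1≃X) (coeffwise P≈[n]R) ⟨
  (X ^ 1 -ₚ oneₚ) *ₚ P                ∎))
  where open ≃-Reasoning

period-1⇒[n]q∣ : ∀ n {P} → Periods.IsPeriod X (X ^ n -ₚ oneₚ) P 1 → [ n ]q ∣ₚ P
period-1⇒[n]q∣ n {P} (Periods.period (R , R[X^n-1]≃[X^1-1]P)) =
  R , coeff-≡ (sym (X-1-cancel {[ n ]q *ₚ R} {P} (begin
    ([ n ]q *ₚ R) *ₚ (X -ₚ oneₚ)   ≈⟨ *-congʳ (*-comm [ n ]q R) ⟩
    (R *ₚ [ n ]q) *ₚ (X -ₚ oneₚ)   ≈⟨ *-assoc R [ n ]q (X -ₚ oneₚ) ⟩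
    R *ₚ ([ n ]q *ₚ (X -ₚ oneₚ))   ≈⟨ *-congˡ {x = R} (X^n-1≃[n]q*[X-1] n) ⟨
    R *ₚ (X ^ n -ₚ oneₚ)           ≈⟨ R[X^n-1]≃[X^1-1]P ⟩
    (X ^ 1 -ₚ oneₚ) *ₚ P           ≈⟨ *-congʳ {x = P} (+-congʳ {x = -ₚ oneₚ} X^1≃X) ⟩
    (X -ₚ oneₚ) *ₚ P               ≈⟨ *-comm (X -ₚ oneₚ) P ⟩
    P *ₚ (X -ₚ oneₚ)               ∎)))
  where open ≃-Reasoning

-- Substitution q ↦ q^(d+1)

expand-∷ : ∀ d c P → expand (suc d) (c ∷ P) ≃ [ c ]ₚ +ₚ X ^ suc d *ₚ expand (suc d) P
expand-∷ d c P = begin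
  c ∷ (replicate d 0ℤ ++ E P)             ≈⟨ ∷≃[c]+X* c _ ⟩
  [ c ]ₚ +ₚ X *ₚ (replicate d 0ℤ ++ E P)  ≈⟨ +-congˡ {x = [ c ]ₚ} (*-congˡ {x = X} (replicate0++≃X^* d (E P))) ⟩
  [ c ]ₚ +ₚ X *ₚ (X ^ d *ₚ E P)           ≈⟨ +-congˡ {x = [ c ]ₚ} (*-assoc X (X ^ d) (E P)) ⟨
  [ c ]ₚ +ₚ X ^ suc d *ₚ E P              ∎
  where
  open ≃-Reasoning
  E : Poly → Poly
  E = expand (suc d)

expand-const : ∀ d c → expand (suc d) [ c ]ₚ ≃ [ c ]ₚ
expand-const d c =
  trans (expand-∷ d c []) (trans (+-congˡ {x = [ c ]ₚ} (zeroʳ (X ^ suc d))) (+-identityʳ [ c ]ₚ))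

expand-shift : ∀ d P → expand (suc d) (shift P) ≃ X ^ suc d *ₚ expand (suc d) P
expand-shift d P = trans (expand-∷ d 0ℤ P) (trans (+-congʳ ([]ₚ-zero ≡.refl)) (+-identityˡ _))

expand-zero : ∀ d {P} → P ≃ [] → expand (suc d) P ≃ []
expand-zero d {[]}    _     = refl
expand-zero d {c ∷ P} c∷P≃0 = begin
  expand (suc d) (c ∷ P)                   ≈⟨ expand-∷ d c P ⟩
  [ c ]ₚ +ₚ X ^ suc d *ₚ expand (suc d) P  ≈⟨ +-cong ([]ₚ-zero (coeff-≡ c∷P≃0 0))
                                                     (*-congˡ {x = X ^ suc d} (expand-zero d (∷-zero c∷P≃0))) ⟩
  [] +ₚ X ^ suc d *ₚ []                    ≈⟨ trans (+-identityˡ _) (zeroʳ (X ^ suc d)) ⟩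
  []                                       ∎
  where open ≃-Reasoning

expand-cong : ∀ d {P Q} → P ≃ Q → expand (suc d) P ≃ expand (suc d) Q
expand-cong d {[]}    {[]}    _   = refl
expand-cong d {[]}    {b ∷ Q} P≃Q = sym (expand-zero d (sym P≃Q))
expand-cong d {a ∷ P} {[]}    P≃Q = expand-zero d P≃Q
expand-cong d {a ∷ P} {b ∷ Q} P≃Q = begin
  expand (suc d) (a ∷ P)                   ≈⟨ expand-∷ d a P ⟩
  [ a ]ₚ +ₚ X ^ suc d *ₚ expand (suc d) P  ≈⟨ +-cong (reflexive (≡.cong [_]ₚ (coeff-≡ P≃Q 0)))
                                                     (*-congˡ {x = X ^ suc d} (expand-cong d (∷-injectiveʳ P≃Q))) ⟩
  [ b ]ₚ +ₚ X ^ suc d *ₚ expand (suc d) Q  ≈⟨ expand-∷ d b Q ⟨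
  expand (suc d) (b ∷ Q)                   ∎
  where open ≃-Reasoning

expand-+ : ∀ d P Q → expand (suc d) (P +ₚ Q) ≃ expand (suc d) P +ₚ expand (suc d) Q
expand-+ d []      Q       = refl
expand-+ d (a ∷ P) []      = sym (+-identityʳ _)
expand-+ d (a ∷ P) (b ∷ Q) = begin
  E ((a ℤ.+ b) ∷ (P +ₚ Q))                     ≈⟨ expand-∷ d (a ℤ.+ b) (P +ₚ Q) ⟩
  ([ a ]ₚ +ₚ [ b ]ₚ) +ₚ Y *ₚ E (P +ₚ Q)         ≈⟨ +-congˡ {x = [ a ]ₚ +ₚ [ b ]ₚ} Y*E[P+Q] ⟩
  ([ a ]ₚ +ₚ [ b ]ₚ) +ₚ (Y *ₚ E P +ₚ Y *ₚ E Q)  ≈⟨ +-interchange [ a ]ₚ [ b ]ₚ (Y *ₚ E P) (Y *ₚ E Q) ⟩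
  ([ a ]ₚ +ₚ Y *ₚ E P) +ₚ ([ b ]ₚ +ₚ Y *ₚ E Q)  ≈⟨ +-cong (expand-∷ d a P) (expand-∷ d b Q) ⟨
  E (a ∷ P) +ₚ E (b ∷ Q)                       ∎
  where
  open ≃-Reasoning
  E : Poly → Poly
  E = expand (suc d)
  Y : Poly
  Y = X ^ suc d
  Y*E[P+Q] : Y *ₚ E (P +ₚ Q) ≃ Y *ₚ E P +ₚ Y *ₚ E Q
  Y*E[P+Q] = trans (*-congˡ {x = Y} (expand-+ d P Q)) (distribˡ Y (E P) (E Q))

expand-*ₛ : ∀ d c P → expand (suc d) (c *ₛ P) ≃ c *ₛ expand (suc d) P
expand-*ₛ d c []      = refl
expand-*ₛ d c (a ∷ P) = begin
  E ((c ℤ.* a) ∷ c *ₛ P)           ≈⟨ expand-∷ d (c ℤ.* a) (c *ₛ P) ⟩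
  c *ₛ [ a ]ₚ +ₚ Y *ₚ E (c *ₛ P)   ≈⟨ +-congˡ {x = c *ₛ [ a ]ₚ} (trans (*-congˡ {x = Y} (expand-*ₛ d c P))
                                                                     (*ₛ-*ʳ c Y (E P))) ⟩
  c *ₛ [ a ]ₚ +ₚ c *ₛ (Y *ₚ E P)   ≈⟨ *ₛ-distrib-+ c [ a ]ₚ (Y *ₚ E P) ⟨
  c *ₛ ([ a ]ₚ +ₚ Y *ₚ E P)        ≈⟨ *ₛ-cong c (expand-∷ d a P) ⟨
  c *ₛ E (a ∷ P)                   ∎
  where
  open ≃-Reasoning
  E : Poly → Poly
  E = expand (suc d)
  Y : Poly
  Y = X ^ suc d

expand-* : ∀ d P Q → expand (suc d) (P *ₚ Q) ≃ expand (suc d) P *ₚ expand (suc d) Q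
expand-* d []      Q = refl
expand-* d (a ∷ P) Q = begin
  E (a *ₛ Q +ₚ shift (P *ₚ Q))            ≈⟨ expand-+ d (a *ₛ Q) (shift (P *ₚ Q)) ⟩
  E (a *ₛ Q) +ₚ E (shift (P *ₚ Q))        ≈⟨ +-cong (trans (expand-*ₛ d a Q) (*ₛ≃[c]* a (E Q)))
                                                    (trans (expand-shift d (P *ₚ Q)) (*-congˡ {x = Y} (expand-* d P Q))) ⟩
  [ a ]ₚ *ₚ E Q +ₚ Y *ₚ (E P *ₚ E Q)      ≈⟨ +-congˡ {x = [ a ]ₚ *ₚ E Q} (*-assoc Y (E P) (E Q)) ⟨
  [ a ]ₚ *ₚ E Q +ₚ (Y *ₚ E P) *ₚ E Q      ≈⟨ distribʳ (E Q) [ a ]ₚ (Y *ₚ E P) ⟨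
  ([ a ]ₚ +ₚ Y *ₚ E P) *ₚ E Q             ≈⟨ *-congʳ (expand-∷ d a P) ⟨
  E (a ∷ P) *ₚ E Q                        ∎
  where
  open ≃-Reasoning
  E : Poly → Poly
  E = expand (suc d)
  Y : Poly
  Y = X ^ suc d

expand-X^ : ∀ d n → expand (suc d) (X ^ n) ≃ X ^ (n ℕ.* suc d)
expand-X^ d zero    = expand-const d 1ℤ
expand-X^ d (suc n) = begin
  expand (suc d) (X *ₚ X ^ n)                 ≈⟨ expand-* d X (X ^ n) ⟩
  expand (suc d) X *ₚ expand (suc d) (X ^ n)  ≈⟨ *-cong expand-X (expand-X^ d n) ⟩
  X ^ suc d *ₚ X ^ (n ℕ.* suc d)              ≈⟨ ^-homo-* X (suc d) (n ℕ.* suc d) ⟨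
  X ^ (suc n ℕ.* suc d)                       ∎
  where
  open ≃-Reasoning
  expand-X : expand (suc d) X ≃ X ^ suc d
  expand-X = begin
    expand (suc d) X                                 ≈⟨ expand-∷ d 0ℤ [ 1ℤ ]ₚ ⟩
    [ 0ℤ ]ₚ +ₚ X ^ suc d *ₚ expand (suc d) [ 1ℤ ]ₚ   ≈⟨ +-cong ([]ₚ-zero ≡.refl)
                                                               (*-congˡ {x = X ^ suc d} (expand-const d 1ℤ)) ⟩
    [] +ₚ X ^ suc d *ₚ oneₚ                          ≈⟨ trans (+-identityˡ _) (*-identityʳ (X ^ suc d)) ⟩
    X ^ suc d                                        ∎

expand-expand : ∀ d e P → expand (suc d) (expand (suc e) P) ≃ expand (suc e ℕ.* suc d) P
expand-expand d e []      = refl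
expand-expand d e (c ∷ P) = begin
  E (expand (suc e) (c ∷ P))
    ≈⟨ expand-cong d (expand-∷ e c P) ⟩
  E ([ c ]ₚ +ₚ X ^ suc e *ₚ expand (suc e) P)
    ≈⟨ expand-+ d [ c ]ₚ (X ^ suc e *ₚ expand (suc e) P) ⟩
  E [ c ]ₚ +ₚ E (X ^ suc e *ₚ expand (suc e) P)
    ≈⟨ +-cong (expand-const d c) (expand-* d (X ^ suc e) (expand (suc e) P)) ⟩
  [ c ]ₚ +ₚ E (X ^ suc e) *ₚ E (expand (suc e) P)
    ≈⟨ +-congˡ {x = [ c ]ₚ} (*-cong (expand-X^ d (suc e)) (expand-expand d e P)) ⟩
  [ c ]ₚ +ₚ X ^ (suc e ℕ.* suc d) *ₚ expand (suc e ℕ.* suc d) P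
    ≈⟨ expand-∷ (d ℕ.+ e ℕ.* suc d) c P ⟨
  expand (suc e ℕ.* suc d) (c ∷ P)
    ∎
  where
  open ≃-Reasoning
  E : Poly → Poly
  E = expand (suc d)

expand-[n]q : ∀ d n → expand (suc d) [ n ]q ≃ geometric (X ^ suc d) n
expand-[n]q d zero    = refl
expand-[n]q d (suc n) =
  trans (expand-∷ d 1ℤ [ n ]q) (+-congˡ {x = oneₚ} (*-congˡ {x = X ^ suc d} (expand-[n]q d n)))

expand-[n]q*[X^d-1] : ∀ d n → expand (suc d) [ n ]q *ₚ (X ^ suc d -ₚ oneₚ) ≃ X ^ (n ℕ.* suc d) -ₚ oneₚ
expand-[n]q*[X^d-1] d n = begin
  expand (suc d) [ n ]q *ₚ (X ^ suc d -ₚ oneₚ)    ≈⟨ *-congʳ (expand-[n]q d n) ⟩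
  geometric (X ^ suc d) n *ₚ (X ^ suc d -ₚ oneₚ)  ≈⟨ geometric*[u-1] (X ^ suc d) n ⟩
  (X ^ suc d) ^ n -ₚ oneₚ                         ≈⟨ +-congʳ (^-assocʳ X (suc d) n) ⟩
  X ^ (suc d ℕ.* n) -ₚ oneₚ                       ≈⟨ +-congʳ (^-congʳ X (ℕ.*-comm (suc d) n)) ⟩
  X ^ (n ℕ.* suc d) -ₚ oneₚ                       ∎
  where open ≃-Reasoning

expand-period : ∀ d n {P} → [ n ]q ∣ₚ P →
                Periods.IsPeriod X (X ^ (n ℕ.* suc d) -ₚ oneₚ) (expand (suc d) P) (suc d)
expand-period d n {P} (R , P≈[n]R) = Periods.period (E R , (begin
  E R *ₚ (X ^ (n ℕ.* suc d) -ₚ oneₚ)          ≈⟨ *-congˡ {x = E R} (expand-[n]q*[X^d-1] d n) ⟨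
  E R *ₚ (E [ n ]q *ₚ (X ^ suc d -ₚ oneₚ))    ≈⟨ x∙yz≈z∙yx (E R) (E [ n ]q) (X ^ suc d -ₚ oneₚ) ⟩
  (X ^ suc d -ₚ oneₚ) *ₚ (E [ n ]q *ₚ E R)    ≈⟨ *-congˡ {x = X ^ suc d -ₚ oneₚ} E[P]≃E[[n]q*R] ⟨
  (X ^ suc d -ₚ oneₚ) *ₚ E P                  ∎))
  where
  open ≃-Reasoning
  E : Poly → Poly
  E = expand (suc d)
  E[P]≃E[[n]q*R] : E P ≃ E [ n ]q *ₚ E R
  E[P]≃E[[n]q*R] = trans (expand-cong d (coeffwise P≈[n]R)) (expand-* d [ n ]q R)

module Σ = BigOperators +-commutativeMonoid

expand-⨁ : ∀ d n f → expand (suc d) (Σ.⨁ n f) ≃ Σ.⨁ n (expand (suc d) ∘ f)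
expand-⨁ d zero    f = refl
expand-⨁ d (suc n) f = trans (expand-+ d (Σ.⨁ n f) (f (suc n))) (+-congʳ (expand-⨁ d n f))

expand-⨁∣ : ∀ d n f → expand (suc d) (Σ.⨁∣ n f) ≃ Σ.⨁∣ n (expand (suc d) ∘ f)
expand-⨁∣ d n f = trans (expand-⨁ d n _) (Σ.⨁-cong n λ k _ _ → expand-when (k ∣? n))
  where
  expand-when : ∀ {k} (D : Dec (k ∣ n)) → expand (suc d) (Σ.when D (f k)) ≃ Σ.when D (expand (suc d) (f k))
  expand-when (yes _) = refl
  expand-when (no _)  = refl

-- a_{n/d}(q^d), indexed by the divisor d itself rather than by d - 1 as in term.
summand : (ℕ → Poly) → ℕ → ℕ → Poly
summand a n d = term a n (ℕ.pred d)

mobSum≃⨁∣ : ∀ a n → mobSum a n ≃ Σ.⨁∣ n (λ d → μ d *ₛ summand a n d)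
mobSum≃⨁∣ a n = trans (Σ.foldr-divisorsPred n _) (Σ.⨁-cong n λ { (suc d) _ _ → refl })

expand-mobSum : ∀ a n d →
                expand (suc d) (mobSum a n) ≃ Σ.⨁∣ n (λ k → μ k *ₛ summand a (n ℕ.* suc d) (k ℕ.* suc d))
expand-mobSum a n d = begin
  expand (suc d) (mobSum a n)                                  ≈⟨ expand-cong d (mobSum≃⨁∣ a n) ⟩
  expand (suc d) (Σ.⨁∣ n (λ k → μ k *ₛ summand a n k))         ≈⟨ expand-⨁∣ d n _ ⟩
  Σ.⨁∣ n (λ k → expand (suc d) (μ k *ₛ summand a n k))         ≈⟨ Σ.⨁∣-cong n (λ { (suc k) _ _ →
                                                                    trans (expand-*ₛ d (μ (suc k)) _)
                                                                          (*ₛ-cong (μ (suc k)) (expand-summand k)) }) ⟩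
  Σ.⨁∣ n (λ k → μ k *ₛ summand a (n ℕ.* suc d) (k ℕ.* suc d))  ∎
  where
  open ≃-Reasoning
  expand-summand : ∀ k → expand (suc d) (summand a n (suc k)) ≃ summand a (n ℕ.* suc d) (suc k ℕ.* suc d)
  expand-summand k = trans (expand-expand d k (a (n / suc k)))
    (reflexive (≡.cong (λ i → expand (suc k ℕ.* suc d) (a i)) (≡.sym (m*n/o*n≡m/o n (suc d) (suc k)))))

⨁∣μ-primeToPart : ∀ {p M m} → Prime p → .{{_ : NonZero M}} → PrimeToPart p M m → (B : ℕ → Poly) →
                  Σ.⨁∣ M (λ d → μ d *ₛ B d) ≃ Σ.⨁∣ m (λ k → μ k *ₛ (B k -ₚ B (p ℕ.* k)))
⨁∣μ-primeToPart {p} {M} {m} p-prime part B = begin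
  Σ.⨁∣ M (λ d → μ d *ₛ B d)
    ≈⟨ Σ.⨁∣-primeToPart p-prime part _ vanish ⟩
  Σ.⨁∣ m (λ k → μ k *ₛ B k) +ₚ Σ.⨁∣ m (λ k → μ (p ℕ.* k) *ₛ B (p ℕ.* k))
    ≈⟨ Σ.⨁∣-∙ m _ _ ⟨
  Σ.⨁∣ m (λ k → μ k *ₛ B k +ₚ μ (p ℕ.* k) *ₛ B (p ℕ.* k))
    ≈⟨ Σ.⨁∣-cong m pair ⟩
  Σ.⨁∣ m (λ k → μ k *ₛ (B k -ₚ B (p ℕ.* k)))
    ∎
  where
  open ≃-Reasoning
  vanish : ∀ k → 1 ≤ k → p ∣ k → μ (p ℕ.* k) *ₛ B (p ℕ.* k) ≃ []
  vanish k 1≤k p∣k = trans (reflexive (≡.cong (_*ₛ B (p ℕ.* k)) (μ-*-∣ p-prime {{ℕ.>-nonZero 1≤k}} p∣k)))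
                           (*ₛ-zeroˡ (B (p ℕ.* k)))
  pair : ∀ k → 1 ≤ k → k ∣ m →
         μ k *ₛ B k +ₚ μ (p ℕ.* k) *ₛ B (p ℕ.* k) ≃ μ k *ₛ (B k -ₚ B (p ℕ.* k))
  pair k 1≤k k∣m = begin
    μ k *ₛ B k +ₚ μ (p ℕ.* k) *ₛ B (p ℕ.* k)
      ≈⟨ +-congˡ {x = μ k *ₛ B k} (reflexive (≡.cong (_*ₛ B (p ℕ.* k)) μpk≡-μk)) ⟩
    μ k *ₛ B k +ₚ ℤ.- μ k *ₛ B (p ℕ.* k)
      ≈⟨ +-congˡ {x = μ k *ₛ B k} (*ₛ-neg (μ k) (B (p ℕ.* k))) ⟩
    μ k *ₛ B k +ₚ μ k *ₛ (-ₚ B (p ℕ.* k))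
      ≈⟨ *ₛ-distrib-+ (μ k) (B k) (-ₚ B (p ℕ.* k)) ⟨
    μ k *ₛ (B k -ₚ B (p ℕ.* k))
      ∎
    where
    μpk≡-μk : μ (p ℕ.* k) ≡ ℤ.- μ k
    μpk≡-μk = μ-*-∤ p-prime {{ℕ.>-nonZero 1≤k}} λ p∣k → PrimeToPart.p∤m part (∣-trans p∣k k∣m)

-- The argument at one prime

module AtPrime (a : ℕ → Poly) {N} .{{_ : NonZero N}}
               (smaller : ∀ n → 1 ≤ n → n < N → [ n ]q ∣ₚ mobSum a n)
               {p m} (p-prime : Prime p) (part : PrimeToPart p N m) where

  open PrimeToPart part
  open Colon (X ^ N -ₚ oneₚ) (X ^ m -ₚ oneₚ)
  module ℛ = CommutativeRing quotientRing
  module ℛP = CommutativeRingProperties quotientRing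
  module Σℛ = BigOperators ℛ.+-commutativeMonoid
  module Πℛ = BigOperators ℛ.*-commutativeMonoid

  instance _ = divisor-nonZero m∣N

  A : ℕ → Poly
  A = summand a N

  D : ℕ → Poly
  D e = A e -ₚ A (p ℕ.* e)

  ⨁∣μ-≋-head : ∀ n .{{_ : NonZero n}} (f : ℕ → Poly) →
               (∀ k → 2 ≤ k → k ∣ n → f k ≋ []) → Σℛ.⨁∣ n (λ k → μ k *ₛ f k) ≋ f 1
  ⨁∣μ-≋-head n f f≋0 =
    ℛ.trans (Σℛ.⨁∣-head n _ λ k 2≤k k∣n → *ₛ-≋0 (μ k) (f≋0 k 2≤k k∣n)) (≈⇒≋ (*ₛ-identityˡ (f 1)))
    where
    *ₛ-≋0 : ∀ c {x} → x ≋ [] → c *ₛ x ≋ []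
    *ₛ-≋0 c {x} x≋0 =
      ℛ.trans (≈⇒≋ (*ₛ≃[c]* c x)) (ℛ.trans (ℛ.*-congˡ {x = [ c ]ₚ} x≋0) (ℛ.zeroʳ [ c ]ₚ))

  module Substituted {d′} (d∣m : 2+ d′ ∣ m) where

    d m′ N′ : ℕ
    d = 2+ d′
    m′ = quotient d∣m
    N′ = quotient (∣-trans d∣m m∣N)
    instance
      m′-nonZero : NonZero m′
      m′-nonZero = quotient≢0 d∣m
      N′-nonZero : NonZero N′
      N′-nonZero = quotient≢0 (∣-trans d∣m m∣N)

    m≡m′d : m ≡ m′ ℕ.* d
    m≡m′d = m∣n⇒n≡quotient*m d∣m

    N≡N′d : N ≡ N′ ℕ.* d
    N≡N′d = m∣n⇒n≡quotient*m (∣-trans d∣m m∣N)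

    T : Poly
    T = expand d (mobSum a N′)

    T≋0 : T ≋ []
    T≋0 = ∣⇒≋0 (Periods.period-∣ (≡.subst (Periods.IsPeriod X (X ^ N -ₚ oneₚ) T) (≡.sym m≡m′d)
            (Periods.period-* X (X ^ N -ₚ oneₚ) T m′
              (≡.subst (λ n → Periods.IsPeriod X (X ^ n -ₚ oneₚ) T d) (≡.sym N≡N′d)
                (expand-period (suc d′) N′ (smaller N′ (ℕ.>-nonZero⁻¹ N′) N′<N))))))
      where
      N′<N : N′ < N
      N′<N = quotient-< (∣-trans d∣m m∣N)

    T≃⨁∣ : T ≃ Σ.⨁∣ m′ (λ k → μ k *ₛ D (k ℕ.* d))
    T≃⨁∣ = begin
      T
        ≈⟨ expand-mobSum a N′ (suc d′) ⟩
      Σ.⨁∣ N′ (λ k → μ k *ₛ summand a (N′ ℕ.* d) (k ℕ.* d))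
        ≡⟨ ≡.cong (λ n → Σ.⨁∣ N′ (λ k → μ k *ₛ summand a n (k ℕ.* d))) (≡.sym N≡N′d) ⟩
      Σ.⨁∣ N′ (λ k → μ k *ₛ A (k ℕ.* d))
        ≈⟨ ⨁∣μ-primeToPart p-prime part′ (λ k → A (k ℕ.* d)) ⟩
      Σ.⨁∣ m′ (λ k → μ k *ₛ (A (k ℕ.* d) -ₚ A (p ℕ.* k ℕ.* d)))
        ≈⟨ Σ.⨁∣-cong m′ (λ k _ _ → reflexive (≡.cong (λ e → μ k *ₛ (A (k ℕ.* d) -ₚ A e))
                                                      (ℕ.*-assoc p k d))) ⟩
      Σ.⨁∣ m′ (λ k → μ k *ₛ D (k ℕ.* d))
        ∎
      where
      open ≃-Reasoning
      part′ : PrimeToPart p N′ m′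
      part′ = primeToPart-÷ p-prime (≡.subst₂ (PrimeToPart p) N≡N′d m≡m′d part)

  -- Downward induction over the divisors of m: the hypothesis for N / d, substituted at q ↦ q^d,
  -- is a Möbius sum over the divisors k of m / d whose terms other than D d vanish by induction.
  D≋0 : ∀ d → 2 ≤ d → d ∣ m → D d ≋ []
  D≋0 d 2≤d d∣m = divisor-descent {P = λ d → 2 ≤ d → D d ≋ []}
    (λ d d∣m larger 2≤d → descent-step d 2≤d d∣m λ e e∣m d<e →
      larger e e∣m d<e (ℕ.≤-trans 2≤d (ℕ.<⇒≤ d<e)))
    d d∣m 2≤d
    where
    descent-step : ∀ d → 2 ≤ d → d ∣ m → (∀ e → e ∣ m → d < e → D e ≋ []) → D d ≋ []
    descent-step 1         (s≤s ()) _ _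
    descent-step d@(2+ _) _ d∣m larger =
      ℛ.trans (ℛ.reflexive (≡.cong D (≡.sym (ℕ.*-identityˡ d))))
        (ℛ.trans (ℛ.sym (⨁∣μ-≋-head m′ (λ k → D (k ℕ.* d)) larger-terms))
          (ℛ.trans (ℛ.sym (≈⇒≋ T≃⨁∣)) T≋0))
      where
      open Substituted d∣m using (m′; m′-nonZero; m≡m′d; T≃⨁∣; T≋0)
      larger-terms : ∀ k → 2 ≤ k → k ∣ m′ → D (k ℕ.* d) ≋ []
      larger-terms k 2≤k k∣m′ = larger (k ℕ.* d) (≡.subst (k ℕ.* d ∣_) (≡.sym m≡m′d) (*-monoˡ-∣ d k∣m′))
                                       (≡.subst (d <_) (ℕ.*-comm d k) (ℕ.m<m*n d k 2≤k))

  A≋A[p*] : ∀ d → 2 ≤ d → d ∣ m → A d ≋ A (p ℕ.* d)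
  A≋A[p*] d 2≤d d∣m = ℛP.x∙y⁻¹≈ε⇒x≈y (A d) (A (p ℕ.* d)) (D≋0 d 2≤d d∣m)

  mobSum≋A1-Ap : mobSum a N ≋ A 1 -ₚ A p
  mobSum≋A1-Ap = begin
    mobSum a N                   ≈⟨ ≈⇒≋ (trans (mobSum≃⨁∣ a N) (⨁∣μ-primeToPart p-prime part A)) ⟩
    Σℛ.⨁∣ m (λ k → μ k *ₛ D k)   ≈⟨ ⨁∣μ-≋-head m D D≋0 ⟩
    A 1 -ₚ A (p ℕ.* 1)           ≡⟨ ≡.cong (λ e → A 1 -ₚ A e) (ℕ.*-identityʳ p) ⟩
    A 1 -ₚ A p                   ∎
    where open import Relation.Binary.Reasoning.Setoid ℛ.setoid

  p∤divisor : ∀ {k} → k ∣ m → p ∤ k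
  p∤divisor k∣m p∣k = p∤m (∣-trans p∣k k∣m)

  μ-*-≡ : ∀ {k c} → 1 ≤ k → k ∣ m → μ (p ℕ.* k) ≡ c ⇔ μ k ≡ ℤ.- c
  μ-*-≡ {k} {c} 1≤k k∣m = mk⇔
    (λ μpk≡c → ≡.trans (≡.sym (ℤ.neg-involutive (μ k))) (≡.cong ℤ.-_ (≡.trans (≡.sym μpk≡-μk) μpk≡c)))
    (λ μk≡-c → ≡.trans μpk≡-μk (≡.trans (≡.cong ℤ.-_ μk≡-c) (ℤ.neg-involutive c)))
    where
    μpk≡-μk : μ (p ℕ.* k) ≡ ℤ.- μ k
    μpk≡-μk = μ-*-∤ p-prime {{ℕ.>-nonZero 1≤k}} (p∤divisor k∣m)

  μ-*-∣≢ : ∀ {k c} → c ≢ 0ℤ → 1 ≤ k → p ∣ k → μ (p ℕ.* k) ≢ c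
  μ-*-∣≢ c≢0 1≤k p∣k μpk≡c = c≢0 (≡.trans (≡.sym μpk≡c) (μ-*-∣ p-prime {{ℕ.>-nonZero 1≤k}} p∣k))

  μ≡-1⇒2≤ : ∀ {k} → 1 ≤ k → μ k ≡ -1ℤ → 2 ≤ k
  μ≡-1⇒2≤ {1}    _ ()
  μ≡-1⇒2≤ {2+ _} _ _ = s≤s (s≤s z≤n)

  prodₚ≋⨁∣ : ∀ {q} {Q : ℕ → Set q} (Q? : Decidable Q) →
             prodₚ (map (term a N) (filter (Q? ∘ suc) (divisorsPred N))) ≋ Πℛ.⨁∣ N (λ d → Πℛ.when (Q? d) (A d))
  prodₚ≋⨁∣ Q? = ℛ.trans (Πℛ.foldr-filter-divisorsPred N (Q? ∘ suc) (term a N))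
                        (Πℛ.⨁∣-cong N λ { (suc d) _ _ → ℛ.refl })

  Πμ : ℤ → (ℕ → Poly) → Poly
  Πμ c B = Πℛ.⨁∣ m (λ k → Πℛ.when (μ k ℤ.≟ c) (B k))

  Πμ-split : ∀ c → c ≢ 0ℤ →
             Πℛ.⨁∣ N (λ d → Πℛ.when (μ d ℤ.≟ c) (A d)) ≋ Πμ c A ℛ.* Πμ (ℤ.- c) (λ k → A (p ℕ.* k))
  Πμ-split c c≢0 =
    ℛ.trans (Πℛ.⨁∣-primeToPart p-prime part _ vanish) (ℛ.*-congˡ {x = Πμ c A} (Πℛ.⨁∣-cong m pointwise))
    where
    vanish : ∀ k → 1 ≤ k → p ∣ k → Πℛ.when (μ (p ℕ.* k) ℤ.≟ c) (A (p ℕ.* k)) ≋ oneₚ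
    vanish k 1≤k p∣k = Πℛ.when-no (μ (p ℕ.* k) ℤ.≟ c) (μ-*-∣≢ c≢0 1≤k p∣k)
    pointwise : ∀ k → 1 ≤ k → k ∣ m →
                Πℛ.when (μ (p ℕ.* k) ℤ.≟ c) (A (p ℕ.* k)) ≋ Πℛ.when (μ k ℤ.≟ ℤ.- c) (A (p ℕ.* k))
    pointwise k 1≤k k∣m = Πℛ.when-cong (μ (p ℕ.* k) ℤ.≟ c) (μ k ℤ.≟ ℤ.- c)
      (Equivalence.to (μ-*-≡ 1≤k k∣m)) (Equivalence.from (μ-*-≡ 1≤k k∣m)) (λ _ → ℛ.refl)

  >1∧μ≡1? : ∀ d → Dec (1 ≤ ℕ.pred d × μ d ≡ 1ℤ)
  >1∧μ≡1? d = (1 ≤? ℕ.pred d) ×-dec (μ d ℤ.≟ 1ℤ)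

  Π⁺ : Poly
  Π⁺ = Πℛ.⨁∣ m (λ k → Πℛ.when (>1∧μ≡1? k) (A k))

  Π⁻ : Poly
  Π⁻ = Πμ -1ℤ (λ k → A (p ℕ.* k))

  >1∧μ≡1-split : Πℛ.⨁∣ N (λ d → Πℛ.when (>1∧μ≡1? d) (A d)) ≋ Π⁺ ℛ.* Π⁻
  >1∧μ≡1-split =
    ℛ.trans (Πℛ.⨁∣-primeToPart p-prime part _ vanish) (ℛ.*-congˡ {x = Π⁺} (Πℛ.⨁∣-cong m pointwise))
    where
    vanish : ∀ k → 1 ≤ k → p ∣ k → Πℛ.when (>1∧μ≡1? (p ℕ.* k)) (A (p ℕ.* k)) ≋ oneₚ
    vanish k 1≤k p∣k = Πℛ.when-no (>1∧μ≡1? (p ℕ.* k)) λ (_ , μpk≡1) → μ-*-∣≢ (λ ()) 1≤k p∣k μpk≡1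
    2≤pk : ∀ {k} → 1 ≤ k → 2 ≤ p ℕ.* k
    2≤pk {k} 1≤k =
      ℕ.≤-trans (ℕ.nonTrivial⇒n>1 p {{prime⇒nonTrivial p-prime}}) (ℕ.m≤m*n p k {{ℕ.>-nonZero 1≤k}})
    pointwise : ∀ k → 1 ≤ k → k ∣ m →
                Πℛ.when (>1∧μ≡1? (p ℕ.* k)) (A (p ℕ.* k)) ≋ Πℛ.when (μ k ℤ.≟ -1ℤ) (A (p ℕ.* k))
    pointwise k 1≤k k∣m = Πℛ.when-cong (>1∧μ≡1? (p ℕ.* k)) (μ k ℤ.≟ -1ℤ)
      (λ (_ , μpk≡1) → Equivalence.to (μ-*-≡ 1≤k k∣m) μpk≡1)
      (λ μk≡-1 → ℕ.pred-mono-≤ (2≤pk 1≤k) , Equivalence.from (μ-*-≡ 1≤k k∣m) μk≡-1)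
      (λ _ → ℛ.refl)

  Πμ1≋B1*Π⁺ : ∀ B → (∀ k → 2 ≤ k → k ∣ m → B k ≋ A k) → Πμ 1ℤ B ≋ B 1 ℛ.* Π⁺
  Πμ1≋B1*Π⁺ B B≋A = ℛ.trans (Πℛ.⨁∣-pull-1 m _) (ℛ.*-congˡ {x = B 1} (Πℛ.⨁∣-cong m pointwise))
    where
    pointwise : ∀ k → 1 ≤ k → k ∣ m →
                Πℛ.when (2 ≤? k) (Πℛ.when (μ k ℤ.≟ 1ℤ) (B k)) ≋ Πℛ.when (>1∧μ≡1? k) (A k)
    pointwise k@(suc k′) _ k∣m = ℛ.trans (Πℛ.when-when (2 ≤? k) (μ k ℤ.≟ 1ℤ))
      (Πℛ.when-cong ((2 ≤? k) ×-dec (μ k ℤ.≟ 1ℤ)) (>1∧μ≡1? k)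
        (λ (2≤k , μk≡1) → ℕ.pred-mono-≤ 2≤k , μk≡1) (λ (1≤k′ , μk≡1) → s≤s 1≤k′ , μk≡1)
        (λ (2≤k , _) → B≋A k 2≤k k∣m))

  posProd≋ : posProd a N ≋ (A 1 ℛ.* Π⁺) ℛ.* Π⁻
  posProd≋ = begin
    posProd a N                                  ≈⟨ prodₚ≋⨁∣ (λ d → μ d ℤ.≟ 1ℤ) ⟩
    Πℛ.⨁∣ N (λ d → Πℛ.when (μ d ℤ.≟ 1ℤ) (A d))   ≈⟨ Πμ-split 1ℤ (λ ()) ⟩
    Πμ 1ℤ A ℛ.* Π⁻                               ≈⟨ ℛ.*-congʳ (Πμ1≋B1*Π⁺ A λ _ _ _ → ℛ.refl) ⟩
    (A 1 ℛ.* Π⁺) ℛ.* Π⁻                          ∎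
    where open import Relation.Binary.Reasoning.Setoid ℛ.setoid

  negProd≋ : negProd a N ≋ Π⁻ ℛ.* (A p ℛ.* Π⁺)
  negProd≋ = begin
    negProd a N
      ≈⟨ prodₚ≋⨁∣ (λ d → μ d ℤ.≟ -1ℤ) ⟩
    Πℛ.⨁∣ N (λ d → Πℛ.when (μ d ℤ.≟ -1ℤ) (A d))
      ≈⟨ Πμ-split -1ℤ (λ ()) ⟩
    Πμ -1ℤ A ℛ.* Πμ 1ℤ (λ k → A (p ℕ.* k))
      ≈⟨ ℛ.*-cong (Πℛ.⨁∣-cong m towards-p) (Πμ1≋B1*Π⁺ _ λ k 2≤k k∣m → ℛ.sym (A≋A[p*] k 2≤k k∣m)) ⟩
    Π⁻ ℛ.* (A (p ℕ.* 1) ℛ.* Π⁺)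
      ≡⟨ ≡.cong (λ e → Π⁻ ℛ.* (A e ℛ.* Π⁺)) (ℕ.*-identityʳ p) ⟩
    Π⁻ ℛ.* (A p ℛ.* Π⁺)
      ∎
    where
    open import Relation.Binary.Reasoning.Setoid ℛ.setoid
    towards-p : ∀ k → 1 ≤ k → k ∣ m →
                Πℛ.when (μ k ℤ.≟ -1ℤ) (A k) ≋ Πℛ.when (μ k ℤ.≟ -1ℤ) (A (p ℕ.* k))
    towards-p k 1≤k k∣m =
      Πℛ.when-cong (μ k ℤ.≟ -1ℤ) (μ k ℤ.≟ -1ℤ) id id λ μk≡-1 → A≋A[p*] k (μ≡-1⇒2≤ 1≤k μk≡-1) k∣m

  posProd>1≋ : posProd>1 a N ≋ Π⁺ ℛ.* Π⁻
  posProd>1≋ = ℛ.trans (prodₚ≋⨁∣ >1∧μ≡1?) >1∧μ≡1-split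

  primeToPart-period : posProd a N ≡ negProd a N [modₚ [ N ]q ] →
                       Periods.IsPeriod X (X ^ N -ₚ oneₚ) (mobSum a N *ₚ posProd>1 a N) m
  primeToPart-period [N]q∣pos-neg = Periods.period (≋0⇒∣ (begin
    mobSum a N *ₚ posProd>1 a N                ≈⟨ ℛ.*-cong mobSum≋A1-Ap posProd>1≋ ⟩
    (A 1 -ₚ A p) *ₚ (Π⁺ *ₚ Π⁻)                 ≈⟨ ℛP.[x-y][zw]≈[xz]w-w[yz] (A 1) (A p) Π⁺ Π⁻ ⟩
    (A 1 *ₚ Π⁺) *ₚ Π⁻ -ₚ Π⁻ *ₚ (A p *ₚ Π⁺)     ≈⟨ ℛ.+-cong posProd≋ (ℛ.-‿cong negProd≋) ⟨
    posProd a N -ₚ negProd a N                 ≈⟨ ∣⇒≋0 (Periods.period-∣ pos-neg-period) ⟩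
    []                                         ∎))
    where
    open import Relation.Binary.Reasoning.Setoid ℛ.setoid
    pos-neg-period : Periods.IsPeriod X (X ^ N -ₚ oneₚ) (posProd a N -ₚ negProd a N) m
    pos-neg-period = ≡.subst (Periods.IsPeriod X (X ^ N -ₚ oneₚ) _) (ℕ.*-identityʳ m)
      (Periods.period-* X (X ^ N -ₚ oneₚ) _ m ([n]q∣⇒period-1 N [N]q∣pos-neg))

lemma3 : (a : ℕ → Poly) (N : ℕ) → 1 ≤ N
       → posProd a N ≡ negProd a N [modₚ [ N ]q ]
       → (∀ n → 1 ≤ n → n < N → [ n ]q ∣ₚ mobSum a n)
       → [ N ]q ∣ₚ (mobSum a N *ₚ posProd>1 a N)
lemma3 a N 1≤N pos≡neg smaller =
  period-1⇒[n]q∣ N (gcd-closed⇒1 (gcd-closed {P = IsPeriod} period-* period-∸) N-period prime-free)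
  where
  instance _ = ℕ.>-nonZero 1≤N
  open Periods X (X ^ N -ₚ oneₚ) (mobSum a N *ₚ posProd>1 a N)
  N-period : IsPeriod N
  N-period = period (mobSum a N *ₚ posProd>1 a N , *-comm (mobSum a N *ₚ posProd>1 a N) (X ^ N -ₚ oneₚ))
  prime-free : ∀ {p} → Prime p → p ∣ N → ∃[ m ] IsPeriod m × p ∤ m
  prime-free p-prime p∣N with primeToPart p-prime p∣N
  ... | m , part = m , AtPrime.primeToPart-period a smaller p-prime part pos≡neg , PrimeToPart.p∤m part
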